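{- Let $t$ be an integer with $t\geq 2$ and let $p,c$ be positive integers. Let $G$ be a $K_t$-minor-free graph, let $r$ be an integer with $0\leq r\leq t-2$, and let $R_1,\dots,R_r$ be pairwise disjoint subsets of $V(G)$ with $|R_i|\in\{1,2\}$ for every $i\in[r]$. Let $\phi$ be a $(p,c)$-good coloring of $G-\bigcup_{i\in[r]}R_i$. Then there are a partition $\mathcal{P}$ of $V(G)$, a tree decomposition $\mathcal{W}=(T,(W_x\mid x\in V(T)))$ of $G/\mathcal{P}$ of width at most $t-2$, and an elimination ordering $\sigma=(P_1,\dots,P_\ell)$ of $\mathcal{W}$ such that (a) $P_i=R_i$ for every $i\in[r]$; (b) there exists $s\in V(T)$ such that $R_1,\dots,R_r\in W_s$; (c) for every $P\in\mathcal{P}\setminus\{R_1,\dots,R_r\}$, there is a coloring $\psi_P\colon P\to[c\cdot 2^{t-2}(t-1)]$ such that for every connected subgraph $H$ of $G\left[\bigcup\{Q\in\mathcal{P}\mid Q\geq_\sigma P\}\right]$ with $V(H)\cap P\neq\emptyset$, either $|\phi(V(H))|>p$, or $V(H)\cap P$ has a $\phi\times\psi_P$-center.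
   Context: Graphs are finite; connected graphs are nonnull; $[k]=\{1,\dots,k\}$, $[0]=\emptyset$. A coloring of a graph is a function on its vertex set; product coloring $(\phi_1\times\phi_2)(u)=(\phi_1(u),\phi_2(u))$; for $S'$ a set of vertices, $u\in S'$ is a $\varphi$-center of $S'$ if $\varphi(u)\notin\varphi(S'\setminus\{u\})$. For $X\subseteq V(G)$, $N_G(X)=\bigcup_{u\in X}N_G(u)\setminus X$. Given positive integers $p,c$, a coloring $\phi$ of a graph $G'$ is $(p,c)$-good if for every subgraph $G_0$ of $G'$, every family $\mathcal{F}$ of connected subgraphs of $G_0$, and every positive integer $d$, if there are no $d+1$ pairwise vertex-disjoint members of $\mathcal{F}$, then there exist $Z\subseteq V(G_0)$ and $\psi\colon Z\to[c\cdot d]$ such that (1) $V(F)\cap Z\neq\emptyset$ for every $F\in\mathcal{F}$; (2) for every connected subgraph $H$ of $G_0$ with $V(H)\cap Z\neq\emptyset$, either $|\phi(V(H))|>p$ or $V(H)\cap Z$ has a $(\phi\times\psi)$-center; (3) for every component $C$ of $G_0-Z$, $N_{G_0}(V(C))$ intersects at most two components of $G_0-V(C)$. A partition consists of nonempty pairwise disjoint sets covering the ground set. For a partition $\mathcal{P}$ of $V(G)$, the quotient graph $G/\mathcal{P}$ has vertex set $\mathcal{P}$, with distinct $P,P'$ adjacent iff some edge of $G$ joins $P$ and $P'$. A tree decomposition of a graph $J$ is $(T,(W_x\mid x\in V(T)))$ with $T$ a tree, $W_x\subseteq V(J)$, each vertex's set of bags inducing a connected subtree, and each edge contained in some bag;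 width is $\max_x|W_x|-1$. An elimination ordering is an ordering $(u_1,\dots,u_n)$ of $V(J)$ such that for each $i$ some $x$ satisfies $\bigcup\{W_z\mid u_i\in W_z\}\cap\{u_1,\dots,u_{i-1}\}\subseteq W_x$. $Q\geq_\sigma P$ means $Q$ occurs at or after $P$ in $\sigma$. -}

module Defs where

open import Data.Nat using (ℕ; zero; suc; _≤_; _+_)
open import Data.Fin using (Fin; zero; suc; toℕ; inject₁; fromℕ; _≟_)
open import Data.Bool using (Bool; true; false; _∧_; _∨_; not)
open import Data.Product using (Σ; _×_; _,_)
open import Data.Sum using (_⊎_)
open import Relation.Nullary using (¬_)
open import Relation.Nullary.Decidable using (⌊_⌋)
open import Relation.Binary.PropositionalEquality using (_≡_; _≢_)
open import Function using (_∘_)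

record Graph : Set where
  field
    n   : ℕ
    adj : Fin n → Fin n → Bool
    sym : ∀ u v → adj u v ≡ adj v u
    irr : ∀ u → adj u u ≡ false

size : ∀ {m} → (Fin m → Bool) → ℕ
size {zero}  S = 0
size {suc m} S = b2n (S zero) + size (S ∘ suc)
  where
  b2n : Bool → ℕ
  b2n true  = 1
  b2n false = 0

anyFin : ∀ {m} → (Fin m → Bool) → Bool
anyFin {zero}  P = false
anyFin {suc m} P = P zero ∨ anyFin (P ∘ suc)

data Walk {n : ℕ} (e : Fin n → Fin n → Bool) : Fin n → Fin n → Set where
  here : ∀ {u} → Walk e u u
  step : ∀ {u v w} → e u v ≡ true → Walk e v w → Walk e u w

induce : ∀ {n} → (Fin n → Fin n → Bool) → (Fin n → Bool) → Fin n → Fin n → Bool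
induce e B u v = B u ∧ B v ∧ e u v

InducedConnected : ∀ {n} → (Fin n → Fin n → Bool) → (Fin n → Bool) → Set
InducedConnected e B =
  Σ _ (λ v → B v ≡ true) ×
  (∀ u v → B u ≡ true → B v ≡ true → Walk (induce e B) u v)

KtMinorFree : ℕ → Graph → Set
KtMinorFree t G =
  ¬ Σ (Fin t → Fin n → Bool) (λ B →
      (∀ i → InducedConnected adj (B i)) ×
      (∀ i j → i ≢ j → ∀ v → B i v ≡ true → B j v ≡ false) ×
      (∀ i j → i ≢ j → Σ (Fin n) λ u → Σ (Fin n) λ v →
          B i u ≡ true × B j v ≡ true × adj u v ≡ true))
  where open Graph G

record Subgraph {n : ℕ} (adj : Fin n → Fin n → Bool) : Set where
  field
    vs     : Fin n → Bool
    es     : Fin n → Fin n → Bool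
    es-sym : ∀ u v → es u v ≡ es v u
    es-adj : ∀ u v → es u v ≡ true → adj u v ≡ true
    es-vs  : ∀ u v → es u v ≡ true → vs u ≡ true
open Subgraph public

SubgraphOf : ∀ {n} {adj : Fin n → Fin n → Bool} → Subgraph adj → Subgraph adj → Set
SubgraphOf H G0 =
  (∀ v → vs H v ≡ true → vs G0 v ≡ true) ×
  (∀ u v → es H u v ≡ true → es G0 u v ≡ true)

Connected : ∀ {n} {adj : Fin n → Fin n → Bool} → Subgraph adj → Set
Connected H =
  Σ _ (λ v → vs H v ≡ true) ×
  (∀ u v → vs H u ≡ true → vs H v ≡ true → Walk (es H) u v)

VertexDisjoint : ∀ {n} {adj : Fin n → Fin n → Bool} → Subgraph adj → Subgraph adj → Set
VertexDisjoint H H' = ∀ v → vs H v ≡ true → vs H' v ≡ false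

IsComponent : ∀ {n} → (Fin n → Fin n → Bool) → (Fin n → Bool) → (Fin n → Bool) → Set
IsComponent e Y C =
  (∀ v → C v ≡ true → Y v ≡ true) ×
  InducedConnected e C ×
  (∀ u v → C u ≡ true → Y v ≡ true → e u v ≡ true → C v ≡ true)

Nbr : ∀ {n} → (Fin n → Fin n → Bool) → (Fin n → Bool) → Fin n → Set
Nbr e X v = X v ≡ false × Σ _ λ u → X u ≡ true × e u v ≡ true

-- |κ(S)| > p  : S (intersected with the domain) contains p+1 vertices
-- with pairwise distinct colors, i.e. the image has at least p+1 elements
ManyColors : ∀ {n} {A : Set} → ℕ → (Fin n → Bool) → (Dom : Fin n → Set) →
             ((v : Fin n) → Dom v → A) → Set
ManyColors {n} p S Dom κ =
  Σ (Fin (suc p) → Fin n) λ g →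
  Σ (∀ i → Dom (g i)) λ dg →
    (∀ i → S (g i) ≡ true) ×
    (∀ i j → i ≢ j → κ (g i) (dg i) ≢ κ (g j) (dg j))

IsCenter : ∀ {n} {B : Set} → (Fin n → Bool) → (Dom : Fin n → Set) →
           ((v : Fin n) → Dom v → B) → Fin n → Set
IsCenter S' Dom κ u =
  S' u ≡ true × Σ (Dom u) λ du →
    ∀ w → S' w ≡ true → (dw : Dom w) → w ≢ u → κ w dw ≢ κ u du

HasCenter : ∀ {n} {B : Set} → (Fin n → Bool) → (Dom : Fin n → Set) →
            ((v : Fin n) → Dom v → B) → Set
HasCenter S' Dom κ = Σ _ λ u → IsCenter S' Dom κ u

-- (p,c)-good colorings of G' = G[D] (the graph adj restricted to D),
-- φ is a coloring of V(G') = D.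

Good : ∀ {n} {A : Set} (adj : Fin n → Fin n → Bool) (D : Fin n → Bool) →
       ((v : Fin n) → D v ≡ true → A) → ℕ → ℕ → Set₁
Good {n} {A} adj D φ p c =
  (G0 : Subgraph adj) → (∀ v → vs G0 v ≡ true → D v ≡ true) →
  (F : Subgraph adj → Set) →
  (∀ H → F H → SubgraphOf H G0 × Connected H) →
  (d : ℕ) → 1 ≤ d →
  ¬ Σ (Fin (suc d) → Subgraph adj) (λ M →
       (∀ i → F (M i)) × (∀ i j → i ≢ j → VertexDisjoint (M i) (M j))) →
  Σ (Fin n → Bool) λ Z →
  (∀ v → Z v ≡ true → vs G0 v ≡ true) ×
  Σ ((v : Fin n) → Z v ≡ true → Fin (c Data.Nat.* d)) λ ψ →
    -- (1)
    (∀ H → F H → Σ _ λ v → vs H v ≡ true × Z v ≡ true) ×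
    -- (2)
    (∀ (H : Subgraph adj) → SubgraphOf H G0 → Connected H →
       Σ _ (λ v → vs H v ≡ true × Z v ≡ true) →
       ManyColors p (vs H) (λ v → D v ≡ true) φ ⊎
       HasCenter (λ v → vs H v ∧ Z v)
                 (λ v → D v ≡ true × Z v ≡ true)
                 (λ v dz → φ v (Data.Product.proj₁ dz) , ψ v (Data.Product.proj₂ dz))) ×
    -- (3)
    (∀ C → IsComponent (es G0) (λ v → vs G0 v ∧ not (Z v)) C →
       ¬ Σ (Fin 3 → Fin n → Bool) λ K →
         (∀ i → IsComponent (es G0) (λ v → vs G0 v ∧ not (C v)) (K i)) ×
         (∀ i j → i ≢ j → Σ _ λ v → K i v ≢ K j v) ×
         (∀ i → Σ _ λ v → K i v ≡ true × Nbr (es G0) C v))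

-- A partition (P_1,...,P_ℓ) of Fin n, listed in a fixed order, is given by
-- a surjection f : Fin n → Fin ℓ, with P_j = f⁻¹(j).
block : ∀ {n ℓ} → (Fin n → Fin ℓ) → Fin ℓ → Fin n → Bool
block f j v = ⌊ f v ≟ j ⌋

Surjective : ∀ {n ℓ} → (Fin n → Fin ℓ) → Set
Surjective f = ∀ j → Σ _ λ v → f v ≡ j

QuotAdj : ∀ {n ℓ} → (Fin n → Fin n → Bool) → (Fin n → Fin ℓ) → Fin ℓ → Fin ℓ → Set
QuotAdj adj f j k =
  j ≢ k × Σ _ λ u → Σ _ λ v → f u ≡ j × f v ≡ k × adj u v ≡ true

HasCycle : ∀ {k} → (Fin k → Fin k → Bool) → Set
HasCycle {k} T =
  Σ ℕ λ m → Σ (Fin (3 + m) → Fin k) λ g →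
    (∀ i j → g i ≡ g j → i ≡ j) ×
    (∀ (i : Fin (2 + m)) → T (g (inject₁ i)) (g (suc i)) ≡ true) ×
    T (g (fromℕ (2 + m))) (g zero) ≡ true

IsTree : ∀ {k} → (Fin k → Fin k → Bool) → Set
IsTree T =
  (∀ x y → T x y ≡ T y x) × (∀ x → T x x ≡ false) ×
  InducedConnected T (λ _ → true) × ¬ HasCycle T

IsTreeDecomposition : ∀ {ℓ k} → (Fin ℓ → Fin ℓ → Set) →
                      (Fin k → Fin k → Bool) → (Fin k → Fin ℓ → Bool) → Set
IsTreeDecomposition J T W =
  IsTree T ×
  (∀ v → InducedConnected T (λ x → W x v)) ×
  (∀ u v → J u v → Σ _ λ x → W x u ≡ true × W x v ≡ true)

WidthAtMost : ∀ {ℓ k} → ℕ → (Fin k → Fin ℓ → Bool) → Set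
WidthAtMost w W = ∀ x → size (W x) ≤ suc w

-- the ordering (0,1,...,ℓ-1) of Fin ℓ is an elimination ordering of (T,W)
IsEliminationOrdering : ∀ {ℓ k} → (Fin k → Fin ℓ → Bool) → Set
IsEliminationOrdering W =
  ∀ i → Σ _ λ x → ∀ z j → W z i ≡ true → W z j ≡ true →
        toℕ j Data.Nat.< toℕ i → W x j ≡ true

outside : ∀ {r n} → (Fin r → Fin n → Bool) → Fin n → Bool
outside R v = not (anyFin λ i → R i v)

{-# OPTIONS --safe #-}
-- The parts after R_1, …, R_r are built one level at a time.  Every component C of the vertices not yet
-- placed carries at most t − 2 pairs of disjoint connected sets outside C, covering N(C), each pair lying in
-- one earlier part.  The next part is the set Z ⊆ C that goodness of φ provides for G[C], with the family
-- {one vertex of C} if there is a spare slot (fewer than t − 2 pairs, or a pair not touching C), and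
-- otherwise the connected subgraphs of G[C] touching every pair: among 2^(t−2)(t−1) + 1 disjoint such
-- subgraphs, t − 1 touch the same side of every pair, and with a component of what remains they form a
-- K_t minor.  By (3), the neighbours in C of a component C′ of C − Z lie in at most two components of
-- C − C′, which become its new pair, while some old pair no longer touches C′.  Part P_j is then placed
-- in a tree below the latest part that its region C_j is attached to; regions are nested along
-- attachments, which yields running intersection and the elimination ordering, and the pairs bound every
-- bag by t − 1 parts.
module Submission where

open import Defs
open import Data.Nat as ℕ using (ℕ; zero; suc; _≤_; _<_; z≤n; s≤s; _+_; _*_; _∸_; _^_; _≤ᵇ_)
import Data.Nat.Properties as ℕₚ
open import Data.Fin as Fin using (Fin; zero; suc; toℕ; inject≤; inject₁; fromℕ; fromℕ<; punchIn; punchOut)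
import Data.Fin.Properties as Finₚ
open import Data.Fin.Properties using (any?; all?; ¬∀⟶∃¬; pigeonhole)
open import Data.Bool as Bool using (Bool; true; false; _∧_; _∨_; not; if_then_else_)
open import Data.Bool.Properties using (∧-conicalˡ; ∧-conicalʳ; ∨-comm; T-≡)
open import Function.Bundles using (Equivalence)
open import Data.Product as Product using (Σ; _×_; _,_; proj₁; proj₂; ∃; ∃₂)
open import Data.Sum as Sum using (_⊎_; inj₁; inj₂)
open import Relation.Binary.Definitions using (tri<; tri≈; tri>)
open import Data.Product.Properties using (×-≡,≡→≡)
open import Axiom.UniquenessOfIdentityProofs using (module Decidable⇒UIP)
open import Data.Empty using (⊥; ⊥-elim)
open import Relation.Nullary using (¬_; Dec; yes; no; does)
open import Relation.Nullary.Decidable using (dec-true; dec-false; _×-dec_; decidable-stable)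
open import Relation.Binary.PropositionalEquality using (_≡_; _≢_; refl; sym; trans; cong; subst; module ≡-Reasoning)
open import Function using (_∘_)
open import Function.Definitions using (Injective)
open import Data.Vec.Functional using (_∷_)

Pred : ℕ → Set
Pred n = Fin n → Bool

Rel : ℕ → Set
Rel n = Fin n → Fin n → Bool

_⊆_ : ∀ {n} → Pred n → Pred n → Set
P ⊆ Q = ∀ v → P v ≡ true → Q v ≡ true

_⊆₂_ : ∀ {n} → Rel n → Rel n → Set
e ⊆₂ e′ = ∀ u v → e u v ≡ true → e′ u v ≡ true

Symmetric : ∀ {n} → Rel n → Set
Symmetric e = ∀ u v → e u v ≡ e v u


≡true⇒≢false : ∀ {a} → a ≡ true → a ≢ false
≡true⇒≢false refl ()

≢true⇒≡false : ∀ {a} → a ≢ true → a ≡ false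
≢true⇒≡false {true}  a≢true = ⊥-elim (a≢true refl)
≢true⇒≡false {false} _      = refl

≢false⇒≡true : ∀ {a} → a ≢ false → a ≡ true
≢false⇒≡true {true}  _       = refl
≢false⇒≡true {false} a≢false = ⊥-elim (a≢false refl)

true⊎false : ∀ a → a ≡ true ⊎ a ≡ false
true⊎false true  = inj₁ refl
true⊎false false = inj₂ refl

not≡true⇒≡false : ∀ {a} → not a ≡ true → a ≡ false
not≡true⇒≡false {false} _ = refl

≡false⇒not≡true : ∀ {a} → a ≡ false → not a ≡ true
≡false⇒not≡true refl = refl

not≡false⇒≡true : ∀ {a} → not a ≡ false → a ≡ true
not≡false⇒≡true {true} _ = refl

∧-intro : ∀ {a b} → a ≡ true → b ≡ true → a ∧ b ≡ true
∧-intro refl refl = refl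

∨-introˡ : ∀ {a} b → a ≡ true → a ∨ b ≡ true
∨-introˡ b refl = refl

∨-introʳ : ∀ a {b} → b ≡ true → a ∨ b ≡ true
∨-introʳ true  _ = refl
∨-introʳ false p = p

∨-elim : ∀ a {b} → a ∨ b ≡ true → a ≡ true ⊎ b ≡ true
∨-elim true  _ = inj₁ refl
∨-elim false p = inj₂ p

does⇒ : ∀ {A : Set} (a? : Dec A) → does a? ≡ true → A
does⇒ (yes a) _ = a

find : ∀ {m} (P : Pred m) → (∃ λ i → P i ≡ true) ⊎ (∀ i → P i ≡ false)
find P with any? (λ i → P i Bool.≟ true)
... | yes found = inj₁ found
... | no  none  = inj₂ λ i → ≢true⇒≡false λ p → none (i , p)

anyFin-intro : ∀ {m} (P : Pred m) i → P i ≡ true → anyFin P ≡ true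
anyFin-intro {suc m} P zero    p = ∨-introˡ (anyFin (P ∘ suc)) p
anyFin-intro {suc m} P (suc i) p = ∨-introʳ (P zero) (anyFin-intro (P ∘ suc) i p)

anyFin-elim : ∀ {m} (P : Pred m) → anyFin P ≡ true → ∃ λ i → P i ≡ true
anyFin-elim {suc m} P p with ∨-elim (P zero) p
... | inj₁ p0 = zero , p0
... | inj₂ ps with anyFin-elim (P ∘ suc) ps
...   | i , pi = suc i , pi

≤⇒≤ᵇ≡true : ∀ {i j} → i ≤ j → (i ≤ᵇ j) ≡ true
≤⇒≤ᵇ≡true i≤j = Equivalence.to T-≡ (ℕₚ.≤⇒≤ᵇ i≤j)

≤ᵇ≡true⇒≤ : ∀ {i j} → (i ≤ᵇ j) ≡ true → i ≤ j
≤ᵇ≡true⇒≤ {i} {j} p = ℕₚ.≤ᵇ⇒≤ i j (Equivalence.from T-≡ p)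

>⇒≤ᵇ≡false : ∀ {i j} → j < i → (i ≤ᵇ j) ≡ false
>⇒≤ᵇ≡false j<i = ≢true⇒≡false λ p → ℕₚ.<⇒≱ j<i (≤ᵇ≡true⇒≤ p)

-- Counting

count : Bool → ℕ
count true  = 1
count false = 0

size-suc : ∀ {m} (P : Pred (suc m)) → size P ≡ count (P zero) + size (P ∘ suc)
size-suc P with P zero
... | true  = refl
... | false = refl

size-≤ : ∀ {m} (P : Pred m) → size P ≤ m
size-≤ {zero}  P = z≤n
size-≤ {suc m} P rewrite size-suc P with P zero
... | true  = s≤s (size-≤ (P ∘ suc))
... | false = ℕₚ.m≤n⇒m≤1+n (size-≤ (P ∘ suc))

size-mono : ∀ {m} (P Q : Pred m) → P ⊆ Q → size P ≤ size Q
size-mono {zero}  P Q P⊆Q = z≤n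
size-mono {suc m} P Q P⊆Q rewrite size-suc P | size-suc Q with P zero in p0 | Q zero in q0
... | true  | true  = s≤s (size-mono (P ∘ suc) (Q ∘ suc) (P⊆Q ∘ suc))
... | true  | false = ⊥-elim (≡true⇒≢false (P⊆Q zero p0) q0)
... | false | true  = ℕₚ.m≤n⇒m≤1+n (size-mono (P ∘ suc) (Q ∘ suc) (P⊆Q ∘ suc))
... | false | false = size-mono (P ∘ suc) (Q ∘ suc) (P⊆Q ∘ suc)

size-< : ∀ {m} (P Q : Pred m) → P ⊆ Q → ∀ x → Q x ≡ true → P x ≡ false → size P < size Q
size-< {suc m} P Q P⊆Q zero qx px rewrite size-suc P | size-suc Q | qx | px =
  s≤s (size-mono (P ∘ suc) (Q ∘ suc) (P⊆Q ∘ suc))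
size-< {suc m} P Q P⊆Q (suc x) qx px rewrite size-suc P | size-suc Q with P zero in p0 | Q zero in q0
... | true  | true  = s≤s (size-< (P ∘ suc) (Q ∘ suc) (P⊆Q ∘ suc) x qx px)
... | true  | false = ⊥-elim (≡true⇒≢false (P⊆Q zero p0) q0)
... | false | true  = ℕₚ.m≤n⇒m≤1+n (size-< (P ∘ suc) (Q ∘ suc) (P⊆Q ∘ suc) x qx px)
... | false | false = size-< (P ∘ suc) (Q ∘ suc) (P⊆Q ∘ suc) x qx px

size-empty : ∀ {m} (P : Pred m) → (∀ v → P v ≡ false) → size P ≡ 0
size-empty {zero}  P none = refl
size-empty {suc m} P none rewrite size-suc P | none zero = size-empty (P ∘ suc) (none ∘ suc)

size-complement : ∀ {m} (P : Pred m) → size P + size (not ∘ P) ≡ m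
size-complement {zero}  P = refl
size-complement {suc m} P rewrite size-suc P | size-suc (not ∘ P) with P zero
... | true  = cong suc (size-complement (P ∘ suc))
... | false = trans (ℕₚ.+-suc (size (P ∘ suc)) _) (cong suc (size-complement (P ∘ suc)))

remove : ∀ {m} → Pred m → Fin m → Pred m
remove P x y = if does (y Fin.≟ x) then false else P y

remove-≢ : ∀ {m} (P : Pred m) {x y} → y ≢ x → remove P x y ≡ P y
remove-≢ P {x} {y} y≢x with y Fin.≟ x
... | yes y≡x = ⊥-elim (y≢x y≡x)
... | no  _   = refl

remove-⊆ : ∀ {m} (P : Pred m) x → remove P x ⊆ P
remove-⊆ P x y r with y Fin.≟ x
... | no _ = r

size-remove : ∀ {m} (P : Pred m) x → P x ≡ true → size P ≡ suc (size (remove P x))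
size-remove {suc m} P zero    px rewrite size-suc P | px = refl
size-remove {suc m} P (suc x) px
  rewrite size-suc P | size-suc (remove P (suc x)) | size-remove (P ∘ suc) x px =
  ℕₚ.+-suc (count (P zero)) _

size>0 : ∀ {m} (P : Pred m) x → P x ≡ true → 0 < size P
size>0 P x px rewrite size-remove P x px = s≤s z≤n

size≡0⇒empty : ∀ {m} (P : Pred m) → size P ≡ 0 → ∀ x → P x ≡ false
size≡0⇒empty P size≡0 x = ≢true⇒≡false λ px → ℕₚ.<-irrefl (sym size≡0) (size>0 P x px)

size≤1⇒unique : ∀ {m} (P : Pred m) x y → size P ≤ 1 → P x ≡ true → P y ≡ true → y ≡ x
size≤1⇒unique P x y size≤1 px py with y Fin.≟ x
... | yes y≡x = y≡x
... | no  y≢x = ⊥-elim (≡true⇒≢false (trans (remove-≢ P y≢x) py) (size≡0⇒empty (remove P x) rest≡0 y))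
  where
  rest≡0 : size (remove P x) ≡ 0
  rest≡0 = ℕₚ.n≤0⇒n≡0 (ℕₚ.≤-pred (subst (_≤ 1) (size-remove P x px) size≤1))

size≤2⇒pair : ∀ {m} (P : Pred m) → 0 < size P → size P ≤ 2 →
              ∃₂ λ x y → P x ≡ true × P y ≡ true × (∀ z → P z ≡ true → z ≡ x ⊎ z ≡ y)
size≤2⇒pair P size>0 size≤2 with find P
... | inj₂ none = ⊥-elim (ℕₚ.<-irrefl (sym (size-empty P none)) size>0)
... | inj₁ (x , px) with find (remove P x)
...   | inj₂ none = x , x , px , px , λ z pz → inj₁ (only-x z pz)
  where
  only-x : ∀ z → P z ≡ true → z ≡ x
  only-x z pz with z Fin.≟ x
  ... | yes z≡x = z≡x
  ... | no  z≢x = ⊥-elim (≡true⇒≢false (trans (remove-≢ P z≢x) pz) (none z))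
...   | inj₁ (y , ry) = x , y , px , remove-⊆ P x y ry , x-or-y
  where
  rest≤1 : size (remove P x) ≤ 1
  rest≤1 = ℕₚ.≤-pred (subst (_≤ 2) (size-remove P x px) size≤2)
  x-or-y : ∀ z → P z ≡ true → z ≡ x ⊎ z ≡ y
  x-or-y z pz with z Fin.≟ x
  ... | yes z≡x = inj₁ z≡x
  ... | no  z≢x = inj₂ (size≤1⇒unique (remove P x) y z rest≤1 ry (trans (remove-≢ P z≢x) pz))

fibre₀ : ∀ {N s} → (Fin N → Fin (suc s)) → Pred N
fibre₀ f x = does (f x Fin.≟ zero)

Enumeration : ∀ {m} → Pred m → ℕ → Set
Enumeration {m} P k = Σ (Fin k → Fin m) λ g → Injective _≡_ _≡_ g × (∀ i → P (g i) ≡ true)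

enumerate : ∀ {m} (P : Pred m) k → k ≤ size P → Enumeration P k
enumerate P zero _ = (λ ()) , (λ { {()} }) , (λ ())
enumerate {zero} P (suc k) ()
enumerate {suc m} P (suc k) k<size with P zero in p0 | subst (suc k ≤_) (size-suc P) k<size
... | false | k<rest =
  let (g , g-inj , g∈P) = enumerate (P ∘ suc) (suc k) k<rest
  in suc ∘ g , g-inj ∘ Finₚ.suc-injective , g∈P
... | true | s≤s k≤rest =
  let (g , g-inj , g∈P) = enumerate (P ∘ suc) k k≤rest
  in zero ∷ (suc ∘ g) , cons-injective g-inj , λ { zero → p0 ; (suc i) → g∈P i }
  where
  cons-injective : ∀ {g : Fin k → Fin m} → Injective _≡_ _≡_ g → Injective _≡_ _≡_ (zero ∷ (suc ∘ g))
  cons-injective g-inj {zero}  {zero}  _ = refl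
  cons-injective g-inj {suc i} {suc j} e = cong suc (g-inj (Finₚ.suc-injective e))

size-≤-image : ∀ {m} k (P : Pred m) (g : Fin k → ℕ) → (∀ x → P x ≡ true → ∃ λ i → toℕ x ≡ g i) → size P ≤ k
size-≤-image k P g image with size P ℕ.≤? k
... | yes size≤k = size≤k
... | no  size≰k = ⊥-elim (Finₚ.<-irrefl (e-inj same-element) i<j)
  where
  enum = enumerate P (size P) ℕₚ.≤-refl
  e = proj₁ enum
  e-inj = proj₁ (proj₂ enum)
  index : Fin (size P) → Fin k
  index i = proj₁ (image (e i) (proj₂ (proj₂ enum) i))
  collision = pigeonhole (ℕₚ.≰⇒> size≰k) index
  i = proj₁ collision
  j = proj₁ (proj₂ collision)
  i<j = proj₁ (proj₂ (proj₂ collision))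
  same-element : e i ≡ e j
  same-element = Finₚ.toℕ-injective
    (trans (proj₂ (image (e i) _)) (trans (cong g (proj₂ (proj₂ (proj₂ collision)))) (sym (proj₂ (image (e j) _)))))

pigeonhole-fibre : ∀ s m N (f : Fin N → Fin s) → m * s < N →
                   ∃₂ λ (c : Fin s) (g : Fin (suc m) → Fin N) → Injective _≡_ _≡_ g × (∀ i → f (g i) ≡ c)
pigeonhole-fibre zero m zero f ms<N = ⊥-elim (ℕₚ.n≮0 ms<N)
pigeonhole-fibre zero m (suc N) f ms<N with f zero
... | ()
pigeonhole-fibre (suc s) m N f ms<N with suc m ℕ.≤? size (fibre₀ f)
... | yes large =
  let (g , g-inj , g∈fibre) = enumerate (fibre₀ f) (suc m) large
  in zero , g , g-inj , λ i → does⇒ (f (g i) Fin.≟ zero) (g∈fibre i)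
... | no small =
  let (c , g , g-inj , f′g≡c) = pigeonhole-fibre s m rest f′ ms<rest
  in suc c , e ∘ g , (λ eq → g-inj (e-inj eq)) ,
     λ i → trans (sym (Finₚ.punchIn-punchOut (nonzero (g i)))) (cong suc (f′g≡c i))
  where
  rest = size (not ∘ fibre₀ f)
  enum = enumerate (not ∘ fibre₀ f) rest ℕₚ.≤-refl
  e = proj₁ enum
  e-inj = proj₁ (proj₂ enum)
  nonzero : ∀ i → zero ≢ f (e i)
  nonzero i z≡fe with f (e i) Fin.≟ zero | proj₂ (proj₂ enum) i
  ... | yes _   | ()
  ... | no fe≢z | _ = fe≢z (sym z≡fe)
  f′ : Fin rest → Fin s
  f′ i = punchOut (nonzero i)
  ms<rest : m * s < rest
  ms<rest = ℕₚ.+-cancelˡ-< (size (fibre₀ f)) (m * s) rest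
    (subst (size (fibre₀ f) + m * s <_) (sym (size-complement (fibre₀ f)))
      (ℕₚ.≤-<-trans (ℕₚ.+-monoˡ-≤ (m * s) (ℕₚ.≤-pred (ℕₚ.≰⇒> small)))
        (subst (_< N) (ℕₚ.*-suc m s) ms<N)))

code : ∀ q → (Fin q → Fin 2) → Fin (2 ^ q)
code zero    π = zero
code (suc q) π = Fin.combine (π zero) (code q (π ∘ suc))

code-injective : ∀ q (π π′ : Fin q → Fin 2) → code q π ≡ code q π′ → ∀ a → π a ≡ π′ a
code-injective (suc q) π π′ eq zero    = Finₚ.combine-injectiveˡ (π zero) _ (π′ zero) _ eq
code-injective (suc q) π π′ eq (suc a) =
  code-injective q (π ∘ suc) (π′ ∘ suc) (Finₚ.combine-injectiveʳ (π zero) _ (π′ zero) _ eq) a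

drop-one : ∀ {k} (a₀ : Fin k) →
           Σ ℕ λ k₀ → suc k₀ ≡ k × Σ (Fin k₀ → Fin k) λ emb → Injective _≡_ _≡_ emb ×
             (∀ a → a ≢ a₀ → Σ (Fin k₀) λ a₁ → emb a₁ ≡ a)
drop-one {suc k₀} a₀ =
  k₀ , refl , punchIn a₀ , (λ {j} {k} → Finₚ.punchIn-injective a₀ j k) ,
  λ a a≢a₀ → punchOut (a≢a₀ ∘ sym) , Finₚ.punchIn-punchOut (a≢a₀ ∘ sym)

-- Walks and components

walk-map : ∀ {n} {e e′ : Rel n} → e ⊆₂ e′ → ∀ {u v} → Walk e u v → Walk e′ u v
walk-map e⊆e′ here       = here
walk-map e⊆e′ (step p w) = step (e⊆e′ _ _ p) (walk-map e⊆e′ w)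

_++ʷ_ : ∀ {n} {e : Rel n} {u v w} → Walk e u v → Walk e v w → Walk e u w
here     ++ʷ q = q
step p w ++ʷ q = step p (w ++ʷ q)

walk-reverse : ∀ {n} {e : Rel n} → Symmetric e → ∀ {u v} → Walk e u v → Walk e v u
walk-reverse e-sym here                 = here
walk-reverse e-sym (step {u} {v} p w) = walk-reverse e-sym w ++ʷ step (trans (e-sym v u) p) here

walk-exit : ∀ {n} {e : Rel n} (S : Pred n) {u v} → Walk e u v → S u ≡ true → S v ≡ false →
            ∃₂ λ x y → S x ≡ true × S y ≡ false × e x y ≡ true
walk-exit S here                 su sv = ⊥-elim (≡true⇒≢false su sv)
walk-exit S (step {u} {w} p wk) su sv with true⊎false (S w)
... | inj₁ sw = walk-exit S wk sw sv
... | inj₂ sw = u , w , su , sw , p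

induce⁺ : ∀ {n} (e : Rel n) (B : Pred n) {u v} → B u ≡ true → B v ≡ true → e u v ≡ true → induce e B u v ≡ true
induce⁺ e B bu bv euv = ∧-intro bu (∧-intro bv euv)

induce⁻ : ∀ {n} (e : Rel n) (B : Pred n) u v → induce e B u v ≡ true → B u ≡ true × B v ≡ true × e u v ≡ true
induce⁻ e B u v p = ∧-conicalˡ (B u) _ p , ∧-conicalˡ (B v) _ (∧-conicalʳ (B u) _ p) , ∧-conicalʳ (B v) _ (∧-conicalʳ (B u) _ p)

induce-sym : ∀ {n} {e : Rel n} → Symmetric e → ∀ B → Symmetric (induce e B)
induce-sym {e = e} e-sym B u v with B u | B v
... | true  | true  = e-sym u v
... | true  | false = refl
... | false | true  = refl
... | false | false = refl

induce-mono : ∀ {n} (e : Rel n) {B B′ : Pred n} → B ⊆ B′ → induce e B ⊆₂ induce e B′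
induce-mono e {B} {B′} B⊆B′ u v p =
  let (bu , bv , euv) = induce⁻ e B u v p in induce⁺ e B′ (B⊆B′ u bu) (B⊆B′ v bv) euv

Connected⇒InducedConnected : ∀ {n} {adj : Rel n} (H : Subgraph adj) → Connected H → InducedConnected adj (vs H)
Connected⇒InducedConnected {adj = adj} H (x , walks) =
  x , λ u v hu hv → walk-map within-H (walks u v hu hv)
  where
  within-H : es H ⊆₂ induce adj (vs H)
  within-H a b p = induce⁺ adj (vs H) (es-vs H a b p) (es-vs H b a (trans (es-sym H b a) p)) (es-adj H a b p)

InducedConnected-unrestrict : ∀ {n} (e : Rel n) (B S : Pred n) → InducedConnected (induce e B) S → InducedConnected e S
InducedConnected-unrestrict e B S (s , walks) = s , λ x y sx sy → walk-map forget (walks x y sx sy)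
  where
  forget : induce (induce e B) S ⊆₂ induce e S
  forget u v p = let (su , sv , buv) = induce⁻ (induce e B) S u v p in induce⁺ e S su sv (proj₂ (proj₂ (induce⁻ e B u v buv)))

singleton : ∀ {n} → Fin n → Pred n
singleton x y = does (y Fin.≟ x)

singleton-connected : ∀ {n} (e : Rel n) x → InducedConnected e (singleton x)
singleton-connected e x = (x , dec-true (x Fin.≟ x) refl) , λ y z py pz →
  subst (Walk _ y) (trans (does⇒ (y Fin.≟ x) py) (sym (does⇒ (z Fin.≟ x) pz))) here

InducedConnected-∪ : ∀ {n} {e : Rel n} → Symmetric e → (P Q : Pred n) →
                     InducedConnected e P → InducedConnected e Q →
                     ∀ p q → P p ≡ true → Q q ≡ true → e p q ≡ true →
                     InducedConnected e (λ x → P x ∨ Q x)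
InducedConnected-∪ {e = e} e-sym P Q (_ , walks-P) (_ , walks-Q) p q pp qq epq =
  (p , ∨-introˡ _ pp) ,
  λ x y px py → walk-reverse (induce-sym e-sym P∪Q) (from-p x px) ++ʷ from-p y py
  where
  P∪Q : Pred _
  P∪Q x = P x ∨ Q x
  from-p : ∀ x → P∪Q x ≡ true → Walk (induce e P∪Q) p x
  from-p x px with ∨-elim (P x) px
  ... | inj₁ in-P = walk-map (induce-mono e {P} λ v → ∨-introˡ (Q v)) (walks-P p x pp in-P)
  ... | inj₂ in-Q = step (induce⁺ e P∪Q (∨-introˡ _ pp) (∨-introʳ (P q) qq) epq)
                         (walk-map (induce-mono e {Q} λ v → ∨-introʳ (P v)) (walks-Q q x qq in-Q))

module _ {n} (e : Rel n) (e-sym : Symmetric e) (Y : Pred n) (v : Fin n) (Yv : Y v ≡ true) where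

  private
    grow : Pred n → Pred n
    grow S x = S x ∨ (Y x ∧ anyFin λ u → S u ∧ e u x)

    grow-⊇ : ∀ S → S ⊆ grow S
    grow-⊇ S x = ∨-introˡ _

    reach : ℕ → Pred n
    reach zero    = singleton v
    reach (suc k) = grow (reach k)

    reach-⊆Y : ∀ k → reach k ⊆ Y
    reach-⊆Y zero    x p rewrite does⇒ (x Fin.≟ v) p = Yv
    reach-⊆Y (suc k) x p with ∨-elim (reach k x) p
    ... | inj₁ old = reach-⊆Y k x old
    ... | inj₂ new = ∧-conicalˡ (Y x) _ new

    reach-v : ∀ k → reach k v ≡ true
    reach-v zero    = dec-true (v Fin.≟ v) refl
    reach-v (suc k) = grow-⊇ (reach k) v (reach-v k)

    reach-walk : ∀ k x → reach k x ≡ true → Walk (induce e (reach k)) v x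
    reach-walk zero    x p rewrite does⇒ (x Fin.≟ v) p = here
    reach-walk (suc k) x p with ∨-elim (reach k x) p
    ... | inj₁ old = walk-map (induce-mono e (grow-⊇ (reach k))) (reach-walk k x old)
    ... | inj₂ new =
      let (u , pu) = anyFin-elim _ (∧-conicalʳ (Y x) _ new)
          ru = ∧-conicalˡ (reach k u) _ pu
      in walk-map (induce-mono e (grow-⊇ (reach k))) (reach-walk k u ru)
         ++ʷ step (induce⁺ e (reach (suc k)) (grow-⊇ _ u ru) p (∧-conicalʳ (reach k u) _ pu)) here

    Closed : ℕ → Set
    Closed k = grow (reach k) ⊆ reach k

    -- Each round either closes the set or adds a vertex, so after n rounds it is closed.
    closes : ∀ k → suc k ≤ size (reach k) ⊎ ∃ Closed
    closes zero = inj₁ (size>0 (reach zero) v (reach-v zero))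
    closes (suc k) with closes k
    ... | inj₂ closed = inj₂ closed
    ... | inj₁ large with find (λ x → grow (reach k) x ∧ not (reach k x))
    ...   | inj₁ (x , p) = inj₁ (ℕₚ.≤-trans (s≤s large)
                            (size-< (reach k) (reach (suc k)) (grow-⊇ (reach k)) x
                              (∧-conicalˡ _ _ p) (not≡true⇒≡false (∧-conicalʳ (grow (reach k) x) _ p))))
    ...   | inj₂ none = inj₂ (k , λ x p → not≡false⇒≡true
                          (subst (λ b → b ∧ not (reach k x) ≡ false) p (none x)))

    closed : ∃ Closed
    closed with closes n
    ... | inj₂ c     = c
    ... | inj₁ large = ⊥-elim (ℕₚ.<-irrefl refl (ℕₚ.≤-trans large (size-≤ (reach n))))

  component-of : Σ (Pred n) λ C → IsComponent e Y C × C v ≡ true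
  component-of = C , (reach-⊆Y k , ((v , reach-v k) , connect) , saturated) , reach-v k
    where
    k = proj₁ closed
    C = reach k
    connect : ∀ x y → C x ≡ true → C y ≡ true → Walk (induce e C) x y
    connect x y cx cy = walk-reverse (induce-sym e-sym C) (reach-walk k x cx) ++ʷ reach-walk k y cy
    saturated : ∀ x y → C x ≡ true → Y y ≡ true → e x y ≡ true → C y ≡ true
    saturated x y cx yy exy =
      proj₂ closed y (∨-introʳ (C y) (∧-intro yy (anyFin-intro _ x (∧-intro cx exy))))

component-closed-walk : ∀ {n} {e e′ : Rel n} {Y C : Pred n} → IsComponent e Y C →
                        (∀ u w → e′ u w ≡ true → Y w ≡ true × e u w ≡ true) →
                        ∀ {x y} → Walk e′ x y → C x ≡ true → C y ≡ true
component-closed-walk C-comp inside here                 cx = cx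
component-closed-walk C-comp inside (step {u} {w} p wk) cx =
  component-closed-walk C-comp inside wk (proj₂ (proj₂ C-comp) u w cx (proj₁ (inside u w p)) (proj₂ (inside u w p)))

component-absorbs : ∀ {n} {e : Rel n} {Y C D : Pred n} → IsComponent e Y C → D ⊆ Y → InducedConnected e D →
                    ∀ x → D x ≡ true → C x ≡ true → D ⊆ C
component-absorbs {e = e} {D = D} C-comp D⊆Y (_ , walks) x dx cx y dy =
  component-closed-walk C-comp (λ u w p → let (_ , dw , euw) = induce⁻ e D u w p in D⊆Y w dw , euw) (walks x y dx dy) cx

component-transport : ∀ {n} {e e′ : Rel n} {Y Y′ K : Pred n} → IsComponent e Y K →
                      K ⊆ Y′ → Y′ ⊆ Y →
                      (∀ u w → K u ≡ true → K w ≡ true → e u w ≡ true → e′ u w ≡ true) →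
                      (∀ u w → K u ≡ true → Y′ w ≡ true → e′ u w ≡ true → e u w ≡ true) →
                      IsComponent e′ Y′ K
component-transport {e = e} {e′} {K = K} (_ , (x , walks) , saturated) K⊆Y′ Y′⊆Y inner outer =
  K⊆Y′ ,
  (x , λ u v ku kv → walk-map (λ s t p → let (ks , kt , est) = induce⁻ e K s t p in induce⁺ e′ K ks kt (inner s t ks kt est))
                              (walks u v ku kv)) ,
  λ u w ku yw e′uw → saturated u w ku (Y′⊆Y w yw) (outer u w ku yw e′uw)


ThreeComponentsMeeting : ∀ {n} → Rel n → Pred n → Pred n → Set
ThreeComponentsMeeting {n} e Y N =
  Σ (Fin 3 → Pred n) λ K →
    (∀ i → IsComponent e Y (K i)) ×
    (∀ i j → i ≢ j → Σ (Fin n) λ v → K i v ≢ K j v) ×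
    (∀ i → Σ (Fin n) λ v → K i v ≡ true × N v ≡ true)

two-components-cover : ∀ {n} (e : Rel n) → Symmetric e → (Y N : Pred n) → ¬ ThreeComponentsMeeting e Y N →
                       ∀ y → Y y ≡ true → N y ≡ true →
                       Σ (Fin 2 → Pred n) λ K → (∀ b → IsComponent e Y (K b)) ×
                         (∀ w → Y w ≡ true → N w ≡ true → Σ (Fin 2) λ b → K b w ≡ true)
two-components-cover e e-sym Y N no-three y₁ Yy₁ Ny₁ with find (λ y → Y y ∧ not (K₁ y) ∧ N y)
  where K₁ = proj₁ (component-of e e-sym Y y₁ Yy₁)
... | inj₂ none = (λ _ → K₁) , (λ _ → K₁-component) ,
                  λ w Yw Nw → zero , not≡false⇒≡true (≢true⇒≡false λ ¬K₁w → ≡true⇒≢false (∧-intro Yw (∧-intro ¬K₁w Nw)) (none w))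
  where
  K₁ = proj₁ (component-of e e-sym Y y₁ Yy₁)
  K₁-component = proj₁ (proj₂ (component-of e e-sym Y y₁ Yy₁))
... | inj₁ (y₂ , p) = K , K-component , cover
  where
  comp : ∀ y → Y y ≡ true → _
  comp y Yy = component-of e e-sym Y y Yy
  Yy₂ = ∧-conicalˡ (Y y₂) _ p
  K₁y₂ = not≡true⇒≡false (∧-conicalˡ (not _) _ (∧-conicalʳ (Y y₂) _ p))
  Ny₂ = ∧-conicalʳ (not _) _ (∧-conicalʳ (Y y₂) _ p)
  K : Fin 2 → Pred _
  K zero    = proj₁ (comp y₁ Yy₁)
  K (suc _) = proj₁ (comp y₂ Yy₂)
  K-component : ∀ b → IsComponent e Y (K b)
  K-component zero    = proj₁ (proj₂ (comp y₁ Yy₁))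
  K-component (suc _) = proj₁ (proj₂ (comp y₂ Yy₂))
  K₂y₂ = proj₂ (proj₂ (comp y₂ Yy₂))
  differ : ∀ {a b : Bool} → a ≡ true → b ≡ false → a ≢ b
  differ refl refl ()
  three : ∀ w → Y w ≡ true → N w ≡ true → K zero w ≡ false → K (suc zero) w ≡ false → ThreeComponentsMeeting e Y N
  three w Yw Nw K₁w K₂w = K₃ , K₃-component , distinct , meets
    where
    K₃ : Fin 3 → Pred _
    K₃ zero             = K zero
    K₃ (suc zero)       = K (suc zero)
    K₃ (suc (suc zero)) = proj₁ (comp w Yw)
    K₃-component : ∀ i → IsComponent e Y (K₃ i)
    K₃-component zero             = K-component zero
    K₃-component (suc zero)       = K-component (suc zero)
    K₃-component (suc (suc zero)) = proj₁ (proj₂ (comp w Yw))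
    K₃w = proj₂ (proj₂ (comp w Yw))
    distinct : ∀ i j → i ≢ j → Σ _ λ v → K₃ i v ≢ K₃ j v
    distinct zero             zero             i≢j = ⊥-elim (i≢j refl)
    distinct zero             (suc zero)       _   = y₂ , differ K₂y₂ K₁y₂ ∘ sym
    distinct zero             (suc (suc zero)) _   = w , differ K₃w K₁w ∘ sym
    distinct (suc zero)       zero             _   = y₂ , differ K₂y₂ K₁y₂
    distinct (suc zero)       (suc zero)       i≢j = ⊥-elim (i≢j refl)
    distinct (suc zero)       (suc (suc zero)) _   = w , differ K₃w K₂w ∘ sym
    distinct (suc (suc zero)) zero             _   = w , differ K₃w K₁w
    distinct (suc (suc zero)) (suc zero)       _   = w , differ K₃w K₂w
    distinct (suc (suc zero)) (suc (suc zero)) i≢j = ⊥-elim (i≢j refl)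
    meets : ∀ i → Σ _ λ v → K₃ i v ≡ true × N v ≡ true
    meets zero             = y₁ , proj₂ (proj₂ (comp y₁ Yy₁)) , Ny₁
    meets (suc zero)       = y₂ , K₂y₂ , Ny₂
    meets (suc (suc zero)) = w , K₃w , Nw
  cover : ∀ w → Y w ≡ true → N w ≡ true → Σ (Fin 2) λ b → K b w ≡ true
  cover w Yw Nw with true⊎false (K zero w) | true⊎false (K (suc zero) w)
  ... | inj₁ K₁w | _        = zero , K₁w
  ... | inj₂ _   | inj₁ K₂w = suc zero , K₂w
  ... | inj₂ K₁w | inj₂ K₂w = ⊥-elim (no-three (three w Yw Nw K₁w K₂w))


-- Trees given by parent maps

find-last : ∀ {m} (P : Pred m) →
            (Σ (Fin m) λ a → P a ≡ true × (∀ b → P b ≡ true → toℕ b ≤ toℕ a)) ⊎ (∀ b → P b ≡ false)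
find-last {zero}  P = inj₂ λ ()
find-last {suc m} P with find-last (P ∘ suc) | true⊎false (P zero)
... | inj₁ (a , pa , max) | _       = inj₁ (suc a , pa , λ { zero _ → z≤n ; (suc b) pb → s≤s (max b pb) })
... | inj₂ none           | inj₁ p0 = inj₁ (zero , p0 , λ { zero _ → z≤n ; (suc b) pb → ⊥-elim (≡true⇒≢false pb (none b)) })
... | inj₂ none           | inj₂ p0 = inj₂ λ { zero → p0 ; (suc b) → none b }

argmax : ∀ {N} (g : Fin (suc N) → ℕ) → Σ (Fin (suc N)) λ j → ∀ i → g i ≤ g j
argmax {zero}  g = zero , λ { zero → ℕₚ.≤-refl }
argmax {suc N} g with argmax (g ∘ suc)
... | j , max with g zero ℕ.≤? g (suc j)
...   | yes g₀≤ = suc j , λ { zero → g₀≤ ; (suc i) → max i }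
...   | no  g₀≰ = zero , λ { zero → ℕₚ.≤-refl ; (suc i) → ℕₚ.≤-trans (max i) (ℕₚ.<⇒≤ (ℕₚ.≰⇒> g₀≰)) }

module ParentTree {k : ℕ} (parent : Fin (suc k) → Fin (suc k))
                  (parent-< : ∀ x → x ≢ zero → toℕ (parent x) < toℕ x) where

  nonroot : Fin (suc k) → Bool
  nonroot x = not (does (x Fin.≟ zero))

  edge : Rel (suc k)
  edge x y = (nonroot x ∧ does (parent x Fin.≟ y)) ∨ (nonroot y ∧ does (parent y Fin.≟ x))

  edge-sym : Symmetric edge
  edge-sym x y = ∨-comm (nonroot x ∧ does (parent x Fin.≟ y)) (nonroot y ∧ does (parent y Fin.≟ x))

  nonroot⁺ : ∀ {x} → x ≢ zero → nonroot x ≡ true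
  nonroot⁺ {x} x≢0 = ≡false⇒not≡true (dec-false (x Fin.≟ zero) x≢0)

  nonroot⁻ : ∀ {x} → nonroot x ≡ true → x ≢ zero
  nonroot⁻ {x} p x≡0 = ≡true⇒≢false (dec-true (x Fin.≟ zero) x≡0) (not≡true⇒≡false p)

  edge⁻ : ∀ x y → edge x y ≡ true → (x ≢ zero × parent x ≡ y) ⊎ (y ≢ zero × parent y ≡ x)
  edge⁻ x y p with ∨-elim (nonroot x ∧ does (parent x Fin.≟ y)) p
  ... | inj₁ q = inj₁ (nonroot⁻ (∧-conicalˡ _ _ q) , does⇒ (parent x Fin.≟ y) (∧-conicalʳ (nonroot x) _ q))
  ... | inj₂ q = inj₂ (nonroot⁻ (∧-conicalˡ _ _ q) , does⇒ (parent y Fin.≟ x) (∧-conicalʳ (nonroot y) _ q))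

  parent≢self : ∀ x → x ≢ zero → parent x ≢ x
  parent≢self x x≢0 e = ℕₚ.<-irrefl (cong toℕ e) (parent-< x x≢0)

  edge-irrefl : ∀ x → edge x x ≡ false
  edge-irrefl x = ≢true⇒≡false λ p → no-loop (edge⁻ x x p)
    where
    no-loop : (x ≢ zero × parent x ≡ x) ⊎ (x ≢ zero × parent x ≡ x) → ⊥
    no-loop (inj₁ (x≢0 , e)) = parent≢self x x≢0 e
    no-loop (inj₂ (x≢0 , e)) = parent≢self x x≢0 e

  edge-parent : ∀ x → x ≢ zero → edge x (parent x) ≡ true
  edge-parent x x≢0 = ∨-introˡ _ (∧-intro (nonroot⁺ x≢0) (dec-true (parent x Fin.≟ parent x) refl))

  edge-< : ∀ x y → edge x y ≡ true → toℕ x < toℕ y → parent y ≡ x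
  edge-< x y p x<y with edge⁻ x y p
  ... | inj₁ (x≢0 , e) = ⊥-elim (ℕₚ.<-asym x<y (subst (λ z → toℕ z < toℕ x) e (parent-< x x≢0)))
  ... | inj₂ (_ , e)   = e

  module _ (S : Pred (suc k)) (top : Fin (suc k)) (top∈S : S top ≡ true)
           (up : ∀ x → S x ≡ true → x ≢ top → x ≢ zero × S (parent x) ≡ true) where

    walk-to-top : ∀ fuel x → toℕ x < fuel → S x ≡ true → Walk (induce edge S) x top
    walk-to-top (suc fuel) x x<fuel x∈S with x Fin.≟ top
    ... | yes refl = here
    ... | no  x≢top =
      let (x≢0 , parent∈S) = up x x∈S x≢top
      in step (induce⁺ edge S x∈S parent∈S (edge-parent x x≢0))
              (walk-to-top fuel (parent x) (ℕₚ.<-≤-trans (parent-< x x≢0) (ℕₚ.≤-pred x<fuel)) parent∈S)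

    upward-closed-connected : InducedConnected edge S
    upward-closed-connected = (top , top∈S) , λ x y x∈S y∈S →
      walk-to-top (suc (toℕ x)) x ℕₚ.≤-refl x∈S ++ʷ
      walk-reverse (induce-sym edge-sym S) (walk-to-top (suc (toℕ y)) y ℕₚ.≤-refl y∈S)

  module _ (m : ℕ) (g : Fin (suc (suc (suc m))) → Fin (suc k))
           (forward : ∀ (i : Fin (suc (suc m))) → edge (g (inject₁ i)) (g (suc i)) ≡ true)
           (closing : edge (g (fromℕ (suc (suc m)))) (g zero) ≡ true) where

    cycle-neighbours : ∀ j → Σ (Fin (suc (suc (suc m)))) λ a → Σ (Fin (suc (suc (suc m)))) λ b →
                       a ≢ b × edge (g a) (g j) ≡ true × edge (g j) (g b) ≡ true
    cycle-neighbours zero = fromℕ (suc (suc m)) , suc zero , (λ ()) , closing , forward zero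
    cycle-neighbours (suc j) with j Fin.≟ fromℕ (suc m)
    ... | yes refl = inject₁ j , zero , (λ ()) , forward j , closing
    ... | no j≢last =
      inject₁ j , suc (suc j′) , (λ e → ℕₚ.<-irrefl (cong toℕ e) inject₁j<) ,
      forward j , subst (λ z → edge (g (suc z)) (g (suc (suc j′))) ≡ true) (Finₚ.inject₁-lower₁ j last≢j) (forward (suc j′))
      where
      last≢j : suc m ≢ toℕ j
      last≢j e = j≢last (Finₚ.toℕ-injective (trans (sym e) (sym (Finₚ.toℕ-fromℕ (suc m)))))
      j′ = Fin.lower₁ j last≢j
      inject₁j< : toℕ (inject₁ j) < toℕ (suc (suc j′))
      inject₁j< = subst (_< suc (suc (toℕ j′)))
                    (sym (trans (Finₚ.toℕ-inject₁ j) (trans (cong toℕ (sym (Finₚ.inject₁-lower₁ j last≢j))) (Finₚ.toℕ-inject₁ j′))))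
                    (ℕₚ.≤-trans (ℕₚ.n<1+n (toℕ j′)) (ℕₚ.n≤1+n _))

  -- The highest vertex of a cycle would have two distinct smaller neighbours, both equal to its parent.
  acyclic : ¬ HasCycle edge
  acyclic (m , g , g-inj , forward , closing) =
    a≢b (g-inj a b (trans (sym (edge-< (g a) (g j) ga-gj ga<gj)) (edge-< (g b) (g j) gb-gj gb<gj)))
    where
    top = argmax (toℕ ∘ g)
    j = proj₁ top
    nb = cycle-neighbours m g forward closing j
    a = proj₁ nb
    b = proj₁ (proj₂ nb)
    a≢b = proj₁ (proj₂ (proj₂ nb))
    ga-gj = proj₁ (proj₂ (proj₂ (proj₂ nb)))
    gb-gj = trans (edge-sym (g b) (g j)) (proj₂ (proj₂ (proj₂ (proj₂ nb))))
    below-top : ∀ x → edge (g x) (g j) ≡ true → toℕ (g x) < toℕ (g j)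
    below-top x p = ℕₚ.≤∧≢⇒< (proj₂ top x) λ e →
      ≡true⇒≢false p (subst (λ z → edge z (g j) ≡ false) (sym (Finₚ.toℕ-injective e)) (edge-irrefl (g j)))
    ga<gj = below-top a ga-gj
    gb<gj = below-top b gb-gj

  is-tree : IsTree edge
  is-tree = edge-sym , edge-irrefl ,
            upward-closed-connected (λ _ → true) zero refl (λ x _ x≢0 → x≢0 , refl) , acyclic

-- K_t minors from subgraphs touching attachment pairs

module GraphNotions (G : Graph) where

  open Graph G renaming (sym to adj-sym)

  MinorModel : ℕ → Set
  MinorModel t =
    Σ (Fin t → Fin n → Bool) λ B →
      (∀ i → InducedConnected adj (B i)) ×
      (∀ i j → i ≢ j → ∀ v → B i v ≡ true → B j v ≡ false) ×
      (∀ i j → i ≢ j → Σ (Fin n) λ u → Σ (Fin n) λ v → B i u ≡ true × B j v ≡ true × adj u v ≡ true)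

  Touches : ∀ {q} → Pred n → (Fin q → Fin 2 → Pred n) → Fin q → Set
  Touches S Y a = Σ (Fin 2) λ b → Σ (Fin n) λ u → Σ (Fin n) λ w → S u ≡ true × Y a b w ≡ true × adj u w ≡ true

  touches? : ∀ {q} S (Y : Fin q → Fin 2 → Pred n) a → Dec (Touches S Y a)
  touches? S Y a = any? λ b → any? λ u → any? λ w →
    (S u Bool.≟ true) ×-dec (Y a b w Bool.≟ true) ×-dec (adj u w Bool.≟ true)

  touches-mono : ∀ {q} {S S′} (Y : Fin q → Fin 2 → Pred n) a → S ⊆ S′ → Touches S Y a → Touches S′ Y a
  touches-mono Y a S⊆S′ (b , u , w , su , yw , uw) = b , u , w , S⊆S′ u su , yw , uw

  record AttachmentPairs (C : Pred n) (q : ℕ) : Set where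
    field
      Y          : Fin q → Fin 2 → Pred n
      Y-connected : ∀ a b → InducedConnected adj (Y a b)
      Y-avoids    : ∀ a b v → Y a b v ≡ true → C v ≡ false
      Y-disjoint  : ∀ a a′ → a ≢ a′ → ∀ b b′ v → Y a b v ≡ true → Y a′ b′ v ≡ false

  -- X₀ is extended to a component K of C − (X₁ ∪ … ∪ X_{q+1}); an edge leaving K lands in some X_{γ+1},
  -- which becomes a branch set on its own, and the q pairs are shared out among the other q sets X_{i+1}.
  module AlignedMinor {q} {C : Pred n} (C-connected : InducedConnected adj C) (P : AttachmentPairs C q)
    (π : Fin q → Fin 2) (X : Fin (suc (suc q)) → Pred n)
    (X-connected : ∀ k → InducedConnected adj (X k)) (X⊆C : ∀ k → X k ⊆ C)
    (X-disjoint : ∀ k k′ → k ≢ k′ → ∀ v → X k v ≡ true → X k′ v ≡ false)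
    (X-touches : ∀ k a → Σ (Fin n) λ u → Σ (Fin n) λ w → X k u ≡ true × AttachmentPairs.Y P a (π a) w ≡ true × adj u w ≡ true)
    where

    open AttachmentPairs P

    outer-free : Pred n
    outer-free x = C x ∧ not (anyFin λ k → X (suc k) x)

    X₀⊆outer-free : X zero ⊆ outer-free
    X₀⊆outer-free v x₀v = ∧-intro (X⊆C zero v x₀v) (≡false⇒not≡true (≢true⇒≡false λ any →
      let (k , xk) = anyFin-elim (λ k → X (suc k) v) any in ≡true⇒≢false xk (X-disjoint zero (suc k) (λ ()) v x₀v)))

    x₀ = proj₁ (proj₁ (X-connected zero))
    x₀∈X₀ = proj₂ (proj₁ (X-connected zero))

    K-data = component-of adj adj-sym outer-free x₀ (X₀⊆outer-free x₀ x₀∈X₀)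
    K = proj₁ K-data
    K-component = proj₁ (proj₂ K-data)

    K⊆C : K ⊆ C
    K⊆C v kv = ∧-conicalˡ (C v) _ (proj₁ K-component v kv)

    K-avoids : ∀ k v → K v ≡ true → X (suc k) v ≡ false
    K-avoids k v kv = ≢true⇒≡false λ xv →
      ≡true⇒≢false (anyFin-intro (λ k → X (suc k) v) k xv) (not≡true⇒≡false (∧-conicalʳ (C v) _ (proj₁ K-component v kv)))

    X₀⊆K : X zero ⊆ K
    X₀⊆K = component-absorbs K-component X₀⊆outer-free (X-connected zero) x₀ x₀∈X₀ (proj₂ (proj₂ K-data))

    y₁ = proj₁ (proj₁ (X-connected (suc zero)))
    y₁∈X₁ = proj₂ (proj₁ (X-connected (suc zero)))

    exit = walk-exit K (proj₂ C-connected x₀ y₁ (X⊆C zero x₀ x₀∈X₀) (X⊆C (suc zero) y₁ y₁∈X₁))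
                     (proj₂ (proj₂ K-data)) (≢true⇒≡false λ ky₁ → ≡true⇒≢false y₁∈X₁ (K-avoids zero y₁ ky₁))
    u = proj₁ exit
    w = proj₁ (proj₂ exit)
    u∈K = proj₁ (proj₂ (proj₂ exit))
    w∉K = proj₁ (proj₂ (proj₂ (proj₂ exit)))
    uw-in-C = induce⁻ adj C u w (proj₂ (proj₂ (proj₂ (proj₂ exit))))

    abstract
      γ-data : Σ (Fin (suc q)) λ k → X (suc k) w ≡ true
      γ-data = anyFin-elim _ (not≡false⇒≡true (≢true⇒≡false λ w-free → ≡true⇒≢false
                 (proj₂ (proj₂ K-component) u w u∈K (∧-intro (proj₁ (proj₂ uw-in-C)) w-free) (proj₂ (proj₂ uw-in-C))) w∉K))
    γ = proj₁ γ-data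

    branch : (i : Fin (suc q)) → Dec (γ ≡ i) → Pred n
    branch i (yes _)  = X (suc i)
    branch i (no γ≢i) x = Y (punchOut γ≢i) (π (punchOut γ≢i)) x ∨ X (suc i) x

    B : Fin (suc (suc q)) → Pred n
    B zero    = K
    B (suc i) = branch i (γ Fin.≟ i)

    B-connected : ∀ i → InducedConnected adj (B i)
    B-connected zero = proj₁ (proj₂ K-component)
    B-connected (suc i) with γ Fin.≟ i
    ... | yes _   = X-connected (suc i)
    ... | no γ≢i  =
      let a = punchOut γ≢i
          (x , y , xx , yy , xy) = X-touches (suc i) a
      in InducedConnected-∪ adj-sym (Y a (π a)) (X (suc i)) (Y-connected a (π a)) (X-connected (suc i)) y x yy xx (trans (adj-sym y x) xy)

    B-disjoint : ∀ i j → i ≢ j → ∀ v → B i v ≡ true → B j v ≡ true → ⊥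
    B-disjoint zero zero i≢j = ⊥-elim (i≢j refl)
    B-disjoint zero (suc j) _ v bi bj with γ Fin.≟ j
    ... | yes _ = ≡true⇒≢false bj (K-avoids j v bi)
    ... | no _ with ∨-elim (Y _ _ v) bj
    ...   | inj₁ y = ≡true⇒≢false (K⊆C v bi) (Y-avoids _ _ v y)
    ...   | inj₂ x = ≡true⇒≢false x (K-avoids j v bi)
    B-disjoint (suc i) zero i≢j v bi bj = B-disjoint zero (suc i) (i≢j ∘ sym) v bj bi
    B-disjoint (suc i) (suc j) i≢j v bi bj with γ Fin.≟ i | γ Fin.≟ j
    ... | yes refl | yes refl = i≢j refl
    ... | yes refl | no _ with ∨-elim (Y _ _ v) bj
    ...   | inj₁ y = ≡true⇒≢false (X⊆C (suc γ) v bi) (Y-avoids _ _ v y)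
    ...   | inj₂ x = ≡true⇒≢false x (X-disjoint (suc γ) (suc j) i≢j v bi)
    B-disjoint (suc i) (suc j) i≢j v bi bj | no _ | yes refl with ∨-elim (Y _ _ v) bi
    ...   | inj₁ y = ≡true⇒≢false (X⊆C (suc γ) v bj) (Y-avoids _ _ v y)
    ...   | inj₂ x = ≡true⇒≢false x (X-disjoint (suc γ) (suc i) (i≢j ∘ sym) v bj)
    B-disjoint (suc i) (suc j) i≢j v bi bj | no γ≢i | no γ≢j with ∨-elim (Y _ _ v) bi | ∨-elim (Y _ _ v) bj
    ... | inj₁ yi | inj₁ yj = ≡true⇒≢false yj
                                (Y-disjoint _ _ (λ e → i≢j (cong suc (Finₚ.punchOut-injective γ≢i γ≢j e))) _ _ v yi)
    ... | inj₁ yi | inj₂ xj = ≡true⇒≢false (X⊆C (suc j) v xj) (Y-avoids _ _ v yi)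
    ... | inj₂ xi | inj₁ yj = ≡true⇒≢false (X⊆C (suc i) v xi) (Y-avoids _ _ v yj)
    ... | inj₂ xi | inj₂ xj = ≡true⇒≢false xj (X-disjoint (suc i) (suc j) i≢j v xi)

    Adjacent : Fin (suc (suc q)) → Fin (suc (suc q)) → Set
    Adjacent i j = Σ (Fin n) λ x → Σ (Fin n) λ y → B i x ≡ true × B j y ≡ true × adj x y ≡ true

    adjacent-sym : ∀ i j → Adjacent i j → Adjacent j i
    adjacent-sym i j (x , y , bx , by , xy) = y , x , by , bx , trans (adj-sym y x) xy

    B-adjacent : ∀ i j → i ≢ j → Adjacent i j
    B-adjacent zero zero i≢j = ⊥-elim (i≢j refl)
    B-adjacent zero (suc j) _ with γ Fin.≟ j
    ... | yes refl  = u , w , u∈K , proj₂ γ-data , proj₂ (proj₂ uw-in-C)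
    ... | no γ≢j =
      let (x , y , xx , yy , xy) = X-touches zero (punchOut γ≢j) in x , y , X₀⊆K x xx , ∨-introˡ _ yy , xy
    B-adjacent (suc i) zero i≢j = adjacent-sym zero (suc i) (B-adjacent zero (suc i) (i≢j ∘ sym))
    B-adjacent (suc i) (suc j) i≢j with γ Fin.≟ i | γ Fin.≟ j
    ... | yes refl | yes refl = ⊥-elim (i≢j refl)
    ... | yes refl | no γ≢j =
      let (x , y , xx , yy , xy) = X-touches (suc γ) (punchOut γ≢j) in x , y , xx , ∨-introˡ _ yy , xy
    ... | no γ≢i | yes refl =
      let (x , y , xx , yy , xy) = X-touches (suc γ) (punchOut γ≢i) in y , x , ∨-introˡ _ yy , xx , trans (adj-sym y x) xy
    ... | no γ≢i | no γ≢j =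
      let (x , y , xx , yy , xy) = X-touches (suc i) (punchOut γ≢j) in x , y , ∨-introʳ (Y _ _ x) xx , ∨-introˡ _ yy , xy

    model : MinorModel (suc (suc q))
    model = B , B-connected , (λ i j i≢j v bi → ≢true⇒≡false (B-disjoint i j i≢j v bi)) , B-adjacent

  PairwiseDisjoint : ∀ {k} → (Fin k → Subgraph adj) → Set
  PairwiseDisjoint M = ∀ i j → i ≢ j → VertexDisjoint (M i) (M j)

  -- Pigeonhole on the sides touched: q + 2 of the subgraphs touch the same side of every pair.
  no-many-disjoint-touching :
    ∀ {q} {C : Pred n} → KtMinorFree (suc (suc q)) G → InducedConnected adj C → (P : AttachmentPairs C q) →
    (M : Fin (suc (2 ^ q * suc q)) → Subgraph adj) → (∀ i → vs (M i) ⊆ C) → (∀ i → Connected (M i)) →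
    (∀ i a → Touches (vs (M i)) (AttachmentPairs.Y P) a) → PairwiseDisjoint M → ⊥
  no-many-disjoint-touching {q} Kt-free C-connected P M M⊆C M-connected M-touches M-disjoint =
    Kt-free (AlignedMinor.model C-connected P π X X-connected (M⊆C ∘ g) X-disjoint X-touches)
    where
    open AttachmentPairs P
    side : Fin (suc (2 ^ q * suc q)) → Fin q → Fin 2
    side i a = proj₁ (M-touches i a)
    class = pigeonhole-fibre (2 ^ q) (suc q) _ (code q ∘ side)
              (s≤s (ℕₚ.≤-reflexive (ℕₚ.*-comm (suc q) (2 ^ q))))
    g = proj₁ (proj₂ class)
    g-inj = proj₁ (proj₂ (proj₂ class))
    π : Fin q → Fin 2
    π = side (g zero)
    same-side : ∀ k a → side (g k) a ≡ π a
    same-side k a = code-injective q _ _ (trans (proj₂ (proj₂ (proj₂ class)) k) (sym (proj₂ (proj₂ (proj₂ class)) zero))) a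
    X : Fin (suc (suc q)) → Pred n
    X k = vs (M (g k))
    X-connected : ∀ k → InducedConnected adj (X k)
    X-connected k = Connected⇒InducedConnected (M (g k)) (M-connected (g k))
    X-disjoint : ∀ k k′ → k ≢ k′ → ∀ v → X k v ≡ true → X k′ v ≡ false
    X-disjoint k k′ k≢k′ = M-disjoint (g k) (g k′) (k≢k′ ∘ g-inj)
    X-touches : ∀ k a → Σ (Fin n) λ u → Σ (Fin n) λ w → X k u ≡ true × Y a (π a) w ≡ true × adj u w ≡ true
    X-touches k a with M-touches (g k) a | same-side k a
    ... | b , u , w , xu , yw , uw | refl = u , w , xu , yw , uw

  induced : Pred n → Subgraph adj
  induced S = record
    { vs = S ; es = induce adj S ; es-sym = induce-sym adj-sym S
    ; es-adj = λ u v p → proj₂ (proj₂ (induce⁻ adj S u v p))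
    ; es-vs  = λ u v p → proj₁ (induce⁻ adj S u v p) }

  point : Fin n → Subgraph adj
  point v = record
    { vs = singleton v ; es = λ _ _ → false ; es-sym = λ _ _ → refl ; es-adj = λ _ _ () ; es-vs = λ _ _ () }

  point-connected : ∀ v → Connected (point v)
  point-connected v = (v , dec-true (v Fin.≟ v) refl) , λ x y px py →
    subst (Walk _ x) (trans (does⇒ (x Fin.≟ v) px) (sym (does⇒ (y Fin.≟ v) py))) here

  restrict-extend-pairs :
    ∀ {C C′ : Pred n} {q q₁} → C′ ⊆ C → AttachmentPairs C q →
    (emb : Fin q₁ → Fin q) → Injective _≡_ _≡_ emb →
    (K : Fin 2 → Pred n) → (∀ b → InducedConnected adj (K b)) → (∀ b → K b ⊆ C) →
    (∀ b v → K b v ≡ true → C′ v ≡ false) → AttachmentPairs C′ (suc q₁)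
  restrict-extend-pairs {C} {C′} C′⊆C P emb emb-inj K K-connected K⊆C K-avoids = record
    { Y = Y′ ; Y-connected = Y′-connected ; Y-avoids = Y′-avoids ; Y-disjoint = Y′-disjoint }
    where
    open AttachmentPairs P
    Y′ : Fin (suc _) → Fin 2 → Pred n
    Y′ = K ∷ (Y ∘ emb)
    Y′-connected : ∀ a b → InducedConnected adj (Y′ a b)
    Y′-connected zero    = K-connected
    Y′-connected (suc a) = Y-connected (emb a)
    Y′-avoids : ∀ a b v → Y′ a b v ≡ true → C′ v ≡ false
    Y′-avoids zero    = K-avoids
    Y′-avoids (suc a) b v y = ≢true⇒≡false λ c′ → ≡true⇒≢false (C′⊆C v c′) (Y-avoids (emb a) b v y)
    Y′-disjoint : ∀ a a′ → a ≢ a′ → ∀ b b′ v → Y′ a b v ≡ true → Y′ a′ b′ v ≡ false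
    Y′-disjoint zero    zero     a≢a′ = ⊥-elim (a≢a′ refl)
    Y′-disjoint zero    (suc a′) _    b b′ v k = ≢true⇒≡false λ y → ≡true⇒≢false (K⊆C b v k) (Y-avoids _ b′ v y)
    Y′-disjoint (suc a) zero     _    b b′ v y = ≢true⇒≡false λ k → ≡true⇒≢false (K⊆C b′ v k) (Y-avoids _ b v y)
    Y′-disjoint (suc a) (suc a′) a≢a′ = Y-disjoint (emb a) (emb a′) (λ e → a≢a′ (cong suc (emb-inj e)))

-- Parts and centred colourings

HasCenter-transport :
  ∀ {n} {B₁ B₂ : Set} {S₁ S₂ : Pred n} {D₁ D₂ : Fin n → Set}
  {κ₁ : (v : Fin n) → D₁ v → B₁} {κ₂ : (v : Fin n) → D₂ v → B₂} →
  (g : B₁ → B₂) → Injective _≡_ _≡_ g → S₁ ⊆ S₂ → S₂ ⊆ S₁ →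
  (to : ∀ x → D₁ x → D₂ x) (from : ∀ x → D₂ x → D₁ x) → (∀ x d → from x (to x d) ≡ d) →
  (∀ x d → κ₂ x d ≡ g (κ₁ x (from x d))) → HasCenter S₁ D₁ κ₁ → HasCenter S₂ D₂ κ₂
HasCenter-transport {κ₁ = κ₁} {κ₂} g g-inj S₁⊆S₂ S₂⊆S₁ to from from-to κ₂≡gκ₁ (u , s₁u , du , unique) =
  u , S₁⊆S₂ u s₁u , to u du , λ w s₂w dw w≢u κ-same →
    unique w (S₂⊆S₁ w s₂w) (from w dw) w≢u (g-inj (begin
      g (κ₁ w (from w dw))          ≡⟨ sym (κ₂≡gκ₁ w dw) ⟩
      κ₂ w dw                       ≡⟨ κ-same ⟩
      κ₂ u (to u du)                ≡⟨ κ₂≡gκ₁ u (to u du) ⟩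
      g (κ₁ u (from u (to u du)))   ≡⟨ cong (g ∘ κ₁ u) (from-to u du) ⟩
      g (κ₁ u du)                   ∎))
  where open ≡-Reasoning

R⇒¬outside : ∀ {r n} (R : Fin r → Pred n) i v → R i v ≡ true → outside R v ≡ false
R⇒¬outside R i v Riv = cong not (anyFin-intro (λ i → R i v) i Riv)

block⁺ : ∀ {n ℓ} (f : Fin n → Fin ℓ) {j v} → f v ≡ j → block f j v ≡ true
block⁺ f {j} {v} fv≡j with f v Fin.≟ j
... | yes _    = refl
... | no fv≢j = ⊥-elim (fv≢j fv≡j)

block⁻ : ∀ {n ℓ} (f : Fin n → Fin ℓ) {j v} → block f j v ≡ true → f v ≡ j
block⁻ f {j} {v} p with f v Fin.≟ j
... | yes fv≡j = fv≡j

block-false : ∀ {n ℓ} (f : Fin n → Fin ℓ) {j v} → f v ≢ j → block f j v ≡ false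
block-false f {j} {v} fv≢j with f v Fin.≟ j
... | yes fv≡j = ⊥-elim (fv≢j fv≡j)
... | no _     = refl

cast-injective : ∀ {m k} .(eq : m ≡ k) {x y : Fin m} → Fin.cast eq x ≡ Fin.cast eq y → x ≡ y
cast-injective eq {x} {y} e =
  Finₚ.toℕ-injective (trans (sym (Finₚ.toℕ-cast eq x)) (trans (cong toℕ e) (Finₚ.toℕ-cast eq y)))

-- The construction, level by level

module Construction {A : Set} (t′ p c : ℕ) (G : Graph) (Kt-free : KtMinorFree (suc (suc t′)) G)
  (r : ℕ) (r≤t′ : r ≤ t′) (R : Fin r → Fin (Graph.n G) → Bool)
  (R-disjoint : ∀ i j → i ≢ j → ∀ v → R i v ≡ true → R j v ≡ false)
  (R-size : ∀ i → size (R i) ≡ 1 ⊎ size (R i) ≡ 2)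
  (φ : (v : Fin (Graph.n G)) → outside R v ≡ true → A)
  (φ-good : Good (Graph.adj G) (outside R) φ p c) where

  open Graph G renaming (sym to adj-sym)
  open GraphNotions G

  D : Pred n
  D = outside R

  d : ℕ
  d = 2 ^ t′ * suc t′

  1≤d : 1 ≤ d
  1≤d = ℕₚ.*-mono-≤ (ℕₚ.m^n>0 2 t′) (s≤s (z≤n {t′}))

  record Boundary (h : Fin n → ℕ) (C : Pred n) : Set where
    field
      q      : ℕ
      q≤t′   : q ≤ t′
      pairs  : AttachmentPairs C q
      anchor : Fin q → ℕ
    open AttachmentPairs pairs public
    field
      covers : ∀ w u → C u ≡ true → adj u w ≡ true → C w ≡ false →
               Σ (Fin q) λ a → Σ (Fin 2) λ b → Y a b w ≡ true × h w ≡ anchor a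

  Boundary-cong : ∀ {h h′ C} → (∀ w u → C u ≡ true → adj u w ≡ true → C w ≡ false → h′ w ≡ h w) →
                  Boundary h C → Boundary h′ C
  Boundary-cong h′≡h B = record
    { q = q ; q≤t′ = q≤t′ ; pairs = pairs ; anchor = anchor
    ; covers = λ w u cu uw cw → let (a , b , y , hw) = covers w u cu uw cw in a , b , y , trans (h′≡h w u cu uw cw) hw }
    where open Boundary B

  -- U: vertices not yet placed in a part; h: the level of each placed vertex; m: the next level.
  record Invariant (U : Pred n) (h : Fin n → ℕ) (m : ℕ) : Set where
    field
      r≤m      : r ≤ m
      U⊆D      : U ⊆ D
      h<m      : ∀ v → U v ≡ false → h v < m
      h-R      : ∀ i v → R i v ≡ true → h v ≡ toℕ i
      r≤h      : ∀ v → U v ≡ false → D v ≡ true → r ≤ h v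
      boundary : ∀ C → IsComponent adj U C → Boundary h C

  record Level (f : Fin n → ℕ) (j : ℕ) : Set where
    field
      C           : Pred n
      C-component : IsComponent adj (λ v → j ≤ᵇ f v) C
      Z           : Pred n
      Z⇒level     : ∀ v → Z v ≡ true → f v ≡ j
      level⇒Z     : ∀ v → f v ≡ j → Z v ≡ true
      Z-nonempty  : Σ (Fin n) λ v → Z v ≡ true
      Z⊆C         : Z ⊆ C
      q           : ℕ
      q≤t′        : q ≤ t′
      anchor      : Fin q → ℕ
      covers      : ∀ w u → C u ≡ true → adj u w ≡ true → C w ≡ false → Σ (Fin q) λ a → f w ≡ anchor a
      ψ           : (v : Fin n) → Z v ≡ true → Fin (c * d)
      centered    : ∀ (H : Subgraph adj) → (∀ v → vs H v ≡ true → j ≤ f v) → Connected H →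
                    Σ (Fin n) (λ v → vs H v ≡ true × Z v ≡ true) →
                    ManyColors p (vs H) (λ v → D v ≡ true) φ ⊎
                    HasCenter {B = A × Fin (c * d)} (λ v → vs H v ∧ Z v) (λ v → D v ≡ true × Z v ≡ true)
                              (λ v dz → φ v (proj₁ dz) , ψ v (proj₂ dz))

  record Extension (U : Pred n) (h : Fin n → ℕ) (m : ℕ) : Set where
    field
      ℓ      : ℕ
      f      : Fin n → ℕ
      m≤ℓ    : m ≤ ℓ
      f-old  : ∀ v → U v ≡ false → f v ≡ h v
      f-new  : ∀ v → U v ≡ true → m ≤ f v
      f<ℓ    : ∀ v → f v < ℓ
      levels : ∀ j → m ≤ j → j < ℓ → Level f j

  full-no-many-disjoint-touching : ∀ {q} {C : Pred n} → q ≡ t′ → InducedConnected adj C → (P : AttachmentPairs C q) →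
                 (M : Fin (suc d) → Subgraph adj) → (∀ i → vs (M i) ⊆ C) → (∀ i → Connected (M i)) →
                 (∀ i a → Touches (vs (M i)) (AttachmentPairs.Y P) a) → PairwiseDisjoint M → ⊥
  full-no-many-disjoint-touching refl = no-many-disjoint-touching Kt-free

  module Step {U : Pred n} {h : Fin n → ℕ} {m : ℕ} (inv : Invariant U h m) (v : Fin n) (v∈U : U v ≡ true) where

    open Invariant inv

    C-data = component-of adj adj-sym U v v∈U
    C = proj₁ C-data
    C-component = proj₁ (proj₂ C-data)
    v∈C = proj₂ (proj₂ C-data)
    C⊆U = proj₁ C-component
    C-connected = proj₁ (proj₂ C-component)
    C-saturated = proj₂ (proj₂ C-component)

    open Boundary (boundary C C-component)

    G₀ : Subgraph adj
    G₀ = induced C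

    Spare : Pred n → Set
    Spare S = suc q ≤ t′ ⊎ Σ (Fin q) λ a → ¬ Touches S Y a

    data Mode : Set where
      spare : Spare C → Mode
      full  : q ≡ t′ → (∀ a → Touches C Y a) → Mode

    decide-mode : Dec (suc q ≤ t′) → Dec (∀ a → Touches C Y a) → Mode
    decide-mode (yes room) _         = spare (inj₁ room)
    decide-mode (no ¬room) (yes all) = full (ℕₚ.≤-antisym q≤t′ (ℕₚ.≤-pred (ℕₚ.≰⇒> ¬room))) all
    decide-mode (no _)     (no ¬all) = spare (inj₂ (¬∀⟶∃¬ q _ (touches? C Y) ¬all))

    mode : Mode
    mode = decide-mode (suc q ℕ.≤? t′) (all? (touches? C Y))

    -- With a spare slot the trivial family {v} suffices; otherwise the family consists of the connected
    -- subgraphs of G[C] touching every pair, and K_t-minor-freeness bounds its packing number by d.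
    Family : Mode → Subgraph adj → Set
    Family (spare _)  X = X ≡ point v
    Family (full _ _) X = (SubgraphOf X G₀ × Connected X) × (∀ a → Touches (vs X) Y a)

    family-ok : ∀ md X → Family md X → SubgraphOf X G₀ × Connected X
    family-ok (spare _)  X refl = ((λ x p → subst (λ y → C y ≡ true) (sym (does⇒ (x Fin.≟ v) p)) v∈C) , (λ _ _ ())) ,
                                  point-connected v
    family-ok (full _ _) X (ok , _) = ok

    few-disjoint : ∀ md → ¬ Σ (Fin (suc d) → Subgraph adj) (λ M → (∀ i → Family md (M i)) × PairwiseDisjoint M)
    few-disjoint (spare _) (M , M≡point , disjoint) =
      ≡true⇒≢false (in-M (suc (fromℕ< 1≤d))) (disjoint zero (suc (fromℕ< 1≤d)) (λ ()) v (in-M zero))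
      where
      in-M : ∀ i → vs (M i) v ≡ true
      in-M i rewrite M≡point i = dec-true (v Fin.≟ v) refl
    few-disjoint (full q≡t′ _) (M , fam , disjoint) =
      full-no-many-disjoint-touching q≡t′ C-connected pairs M (λ i → proj₁ (proj₁ (proj₁ (fam i))))
                   (λ i → proj₂ (proj₁ (fam i))) (λ i → proj₂ (fam i)) disjoint

    good = φ-good G₀ (λ x p → U⊆D x (C⊆U x p)) (Family mode) (family-ok mode) d 1≤d (few-disjoint mode)
    Z = proj₁ good
    Z⊆C : Z ⊆ C
    Z⊆C = proj₁ (proj₂ good)
    ψ₀ = proj₁ (proj₂ (proj₂ good))
    Z-hits = proj₁ (proj₂ (proj₂ (proj₂ good)))
    Z-centers = proj₁ (proj₂ (proj₂ (proj₂ (proj₂ good))))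
    Z-sides = proj₂ (proj₂ (proj₂ (proj₂ (proj₂ good))))

    nonempty-for : ∀ md → (∀ H → Family md H → Σ (Fin n) λ x → vs H x ≡ true × Z x ≡ true) → Σ (Fin n) λ z → Z z ≡ true
    nonempty-for (spare _)    hits = let (x , _ , zx) = hits (point v) refl in x , zx
    nonempty-for (full _ all) hits =
      let (x , _ , zx) = hits G₀ ((((λ _ p → p) , (λ _ _ p → p)) , C-connected) , all) in x , zx

    Z-nonempty : Σ (Fin n) λ z → Z z ≡ true
    Z-nonempty = nonempty-for mode Z-hits

    U′ : Pred n
    U′ x = U x ∧ not (Z x)

    h′ : Fin n → ℕ
    h′ x = if Z x then m else h x

    h′-Z : ∀ x → Z x ≡ true → h′ x ≡ m
    h′-Z x zx = cong (λ b → if b then m else h x) zx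

    h′-¬Z : ∀ x → Z x ≡ false → h′ x ≡ h x
    h′-¬Z x zx = cong (λ b → if b then m else h x) zx

    Z⊆U : Z ⊆ U
    Z⊆U x zx = C⊆U x (Z⊆C x zx)

    U′⊆U : U′ ⊆ U
    U′⊆U x p = ∧-conicalˡ (U x) _ p

    U′-¬Z : ∀ x → U′ x ≡ true → Z x ≡ false
    U′-¬Z x p = not≡true⇒≡false (∧-conicalʳ (U x) _ p)

    U′-intro : ∀ x → U x ≡ true → Z x ≡ false → U′ x ≡ true
    U′-intro x ux zx = ∧-intro ux (≡false⇒not≡true zx)

    Z⇒¬U′ : ∀ x → Z x ≡ true → U′ x ≡ false
    Z⇒¬U′ x zx = ≢true⇒≡false λ p → ≡true⇒≢false zx (U′-¬Z x p)

    ¬U⇒¬Z : ∀ x → U x ≡ false → Z x ≡ false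
    ¬U⇒¬Z x ux = ≢true⇒≡false λ zx → ≡true⇒≢false (Z⊆U x zx) ux

    ¬U⇒¬U′ : ∀ x → U x ≡ false → U′ x ≡ false
    ¬U⇒¬U′ x ux = ≢true⇒≡false λ p → ≡true⇒≢false (U′⊆U x p) ux

    Selection : Pred n → Set
    Selection S = Σ ℕ λ q₁ → suc q₁ ≤ t′ × Σ (Fin q₁ → Fin q) λ emb → Injective _≡_ _≡_ emb ×
                    (∀ a → Touches S Y a → Σ (Fin q₁) λ a₁ → emb a₁ ≡ a)

    select : ∀ {S} → Spare S → Selection S
    select (inj₁ room) = q , room , (λ a → a) , (λ e → e) , λ a _ → a , refl
    select {S} (inj₂ (a₀ , ¬touch)) =
      let (q₀ , q≡ , emb , emb-inj , onto) = drop-one a₀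
      in q₀ , subst (_≤ t′) (sym q≡) q≤t′ , emb , emb-inj ,
         λ a touch → onto a λ a≡a₀ → ¬touch (subst (Touches S Y) a≡a₀ touch)

    -- A component C′ of C − Z: its neighbours in C lie in Z and, by (3), in at most two components of
    -- C − C′, which form the new pair at level m; the old pairs not touching C′ are dropped.
    module Inside (C′ : Pred n) (C′-component : IsComponent adj U′ C′) (x : Fin n) (x∈C′ : C′ x ≡ true) (x∈C : C x ≡ true) where

      C′⊆U′ = proj₁ C′-component
      C′-connected = proj₁ (proj₂ C′-component)
      C′-saturated = proj₂ (proj₂ C′-component)

      C′⊆C : C′ ⊆ C
      C′⊆C = component-absorbs C-component (λ y p → U′⊆U y (C′⊆U′ y p)) C′-connected x x∈C′ x∈C

      C′-¬Z : ∀ y → C′ y ≡ true → Z y ≡ false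
      C′-¬Z y p = U′-¬Z y (C′⊆U′ y p)

      rest : Pred n
      rest y = C y ∧ not (C′ y)

      touching : Pred n
      touching y = anyFin λ u → C′ u ∧ adj u y

      spare-for : ∀ md → (∀ H → Family md H → Σ (Fin n) λ y → vs H y ≡ true × Z y ≡ true) → Spare C′
      spare-for (spare (inj₁ room)) _ = inj₁ room
      spare-for (spare (inj₂ (a , ¬touch))) _ = inj₂ (a , ¬touch ∘ touches-mono Y a C′⊆C)
      spare-for (full _ _) hits = decide (all? (touches? C′ Y))
        where
        decide : Dec (∀ a → Touches C′ Y a) → Spare C′
        decide (no ¬all) = inj₂ (¬∀⟶∃¬ q _ (touches? C′ Y) ¬all)
        decide (yes all) =
          let (y , y∈C′ , zy) = hits (induced C′) (((C′⊆C , induce-mono adj C′⊆C) , C′-connected) , all)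
          in ⊥-elim (≡true⇒≢false zy (C′-¬Z y y∈C′))

      selection = select (spare-for mode Z-hits)
      q₁ = proj₁ selection
      emb = proj₁ (proj₂ (proj₂ selection))
      emb-inj = proj₁ (proj₂ (proj₂ (proj₂ selection)))
      emb-onto = proj₂ (proj₂ (proj₂ (proj₂ selection)))

      C′-in-G₀ : IsComponent (induce adj C) (λ y → C y ∧ not (Z y)) C′
      C′-in-G₀ = component-transport C′-component
        (λ y p → ∧-intro (C′⊆C y p) (≡false⇒not≡true (C′-¬Z y p)))
        (λ y p → U′-intro y (C⊆U y (∧-conicalˡ (C y) _ p)) (not≡true⇒≡false (∧-conicalʳ (C y) _ p)))
        (λ u w cu cw uw → induce⁺ adj C (C′⊆C u cu) (C′⊆C w cw) uw)
        (λ u w _ _ p → proj₂ (proj₂ (induce⁻ adj C u w p)))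

      touching⇒neighbour : ∀ y → rest y ≡ true → touching y ≡ true → Nbr (induce adj C) C′ y
      touching⇒neighbour y rest-y t =
        let (u , p) = anyFin-elim (λ u → C′ u ∧ adj u y) t
            u∈C′ = ∧-conicalˡ (C′ u) _ p
        in not≡true⇒≡false (∧-conicalʳ (C y) _ rest-y) , u , u∈C′ ,
           induce⁺ adj C (C′⊆C u u∈C′) (∧-conicalˡ (C y) _ rest-y) (∧-conicalʳ (C′ u) _ p)

      no-three : ¬ ThreeComponentsMeeting (induce adj C) rest touching
      no-three (K , K-component , distinct , meets) =
        Z-sides C′ C′-in-G₀ (K , K-component , distinct , λ i →
          let (y , ky , ty) = meets i in y , ky , touching⇒neighbour y (proj₁ (K-component i) y ky) ty)

      exit : ∃₂ λ x₁ y₁ → C′ x₁ ≡ true × C′ y₁ ≡ false × induce adj C x₁ y₁ ≡ true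
      exit = walk-exit C′ (proj₂ C-connected x z x∈C (Z⊆C z (proj₂ Z-nonempty))) x∈C′
               (≢true⇒≡false λ z∈C′ → ≡true⇒≢false (proj₂ Z-nonempty) (C′-¬Z z z∈C′))
        where z = proj₁ Z-nonempty

      y₁ : Fin n
      y₁ = proj₁ (proj₂ exit)

      y₁∈rest : rest y₁ ≡ true
      y₁∈rest = ∧-intro (proj₁ (proj₂ (induce⁻ adj C _ _ (proj₂ (proj₂ (proj₂ (proj₂ exit)))))))
                        (≡false⇒not≡true (proj₁ (proj₂ (proj₂ (proj₂ exit)))))

      y₁-touching : touching y₁ ≡ true
      y₁-touching = anyFin-intro (λ u → C′ u ∧ adj u y₁) (proj₁ exit)
        (∧-intro (proj₁ (proj₂ (proj₂ exit))) (proj₂ (proj₂ (induce⁻ adj C _ _ (proj₂ (proj₂ (proj₂ (proj₂ exit))))))))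

      sides : Σ (Fin 2 → Pred n) λ K → (∀ b → IsComponent (induce adj C) rest (K b)) ×
                (∀ w → rest w ≡ true → touching w ≡ true → Σ (Fin 2) λ b → K b w ≡ true)
      sides = two-components-cover (induce adj C) (induce-sym adj-sym C) rest touching no-three y₁ y₁∈rest y₁-touching
      K = proj₁ sides
      K-component = proj₁ (proj₂ sides)
      K-covers = proj₂ (proj₂ sides)

      K⊆rest : ∀ b → K b ⊆ rest
      K⊆rest b = proj₁ (K-component b)

      K-connected : ∀ b → InducedConnected adj (K b)
      K-connected b = InducedConnected-unrestrict adj C (K b) (proj₁ (proj₂ (K-component b)))

      pairs′ : AttachmentPairs C′ (suc q₁)
      pairs′ = restrict-extend-pairs C′⊆C pairs emb emb-inj K K-connected
                 (λ b y p → ∧-conicalˡ (C y) _ (K⊆rest b y p))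
                 (λ b y p → not≡true⇒≡false (∧-conicalʳ (C y) _ (K⊆rest b y p)))

      anchor′ : Fin (suc q₁) → ℕ
      anchor′ = m ∷ (anchor ∘ emb)

      Covered′ : Fin n → Set
      Covered′ w = Σ (Fin (suc q₁)) λ a → Σ (Fin 2) λ b → AttachmentPairs.Y pairs′ a b w ≡ true × h′ w ≡ anchor′ a

      new-side : ∀ w → Z w ≡ true → Σ (Fin 2) (λ b → K b w ≡ true) → Covered′ w
      new-side w zw (b , kw) = zero , b , kw , h′-Z w zw

      old-side : ∀ w u → C′ u ≡ true → adj u w ≡ true → C w ≡ false →
                 Σ (Fin q) (λ a → Σ (Fin 2) λ b → Y a b w ≡ true × h w ≡ anchor a) → Covered′ w
      old-side w u u∈C′ uw w∉C (a , b , yw , hw) = kept (emb-onto a (b , u , w , u∈C′ , yw , uw))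
        where
        kept : Σ (Fin q₁) (λ a₁ → emb a₁ ≡ a) → Covered′ w
        kept (a₁ , refl) = suc a₁ , b , yw , trans (h′-¬Z w (≢true⇒≡false λ zw → ≡true⇒≢false (Z⊆C w zw) w∉C)) hw

      covers′ : ∀ w u → C′ u ≡ true → adj u w ≡ true → C′ w ≡ false → Covered′ w
      covers′ w u u∈C′ uw w∉C′ = by-side (true⊎false (C w))
        where
        by-side : C w ≡ true ⊎ C w ≡ false → Covered′ w
        by-side (inj₁ w∈C) =
          new-side w (≢false⇒≡true λ ¬zw → ≡true⇒≢false (C′-saturated u w u∈C′ (U′-intro w (C⊆U w w∈C) ¬zw) uw) w∉C′)
                     (K-covers w (∧-intro w∈C (≡false⇒not≡true w∉C′)) (anyFin-intro _ u (∧-intro u∈C′ uw)))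
        by-side (inj₂ w∉C) = old-side w u u∈C′ uw w∉C (covers w u (C′⊆C u u∈C′) uw w∉C)

      boundary′ : Boundary h′ C′
      boundary′ = record { q = suc q₁ ; q≤t′ = proj₁ (proj₂ selection) ; pairs = pairs′ ; anchor = anchor′ ; covers = covers′ }

    -- A component of U′ avoiding C is a component of U, and its boundary is untouched.
    module Apart (C′ : Pred n) (C′-component : IsComponent adj U′ C′) (C′∩C : ∀ y → C′ y ≡ true → C y ≡ false) where

      C′-in-U : IsComponent adj U C′
      C′-in-U = (λ y p → U′⊆U y (proj₁ C′-component y p)) , proj₁ (proj₂ C′-component) , saturated
        where
        saturated : ∀ u w → C′ u ≡ true → U w ≡ true → adj u w ≡ true → C′ w ≡ true
        saturated u w u∈C′ w∈U uw = by-Z (true⊎false (Z w))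
          where
          by-Z : Z w ≡ true ⊎ Z w ≡ false → C′ w ≡ true
          by-Z (inj₁ zw) = ⊥-elim (≡true⇒≢false
                             (C-saturated w u (Z⊆C w zw) (U′⊆U u (proj₁ C′-component u u∈C′)) (trans (adj-sym w u) uw))
                             (C′∩C u u∈C′))
          by-Z (inj₂ zw) = proj₂ (proj₂ C′-component) u w u∈C′ (U′-intro w w∈U zw) uw

      boundary′ : Boundary h′ C′
      boundary′ = Boundary-cong
        (λ w u u∈C′ uw w∉C′ → h′-¬Z w (¬U⇒¬Z w (≢true⇒≡false λ wU → ≡true⇒≢false (proj₂ (proj₂ C′-in-U) u w u∈C′ wU uw) w∉C′)))
        (boundary C′ C′-in-U)

    boundary-of : ∀ C′ → IsComponent adj U′ C′ → Boundary h′ C′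
    boundary-of C′ C′-component = by-meeting (find (λ y → C′ y ∧ C y))
      where
      by-meeting : (∃ λ y → (C′ y ∧ C y) ≡ true) ⊎ (∀ y → (C′ y ∧ C y) ≡ false) → Boundary h′ C′
      by-meeting (inj₁ (x , p)) = Inside.boundary′ C′ C′-component x (∧-conicalˡ (C′ x) _ p) (∧-conicalʳ (C′ x) _ p)
      by-meeting (inj₂ none)    = Apart.boundary′ C′ C′-component λ y y∈C′ →
                                    ≢true⇒≡false λ y∈C → ≡true⇒≢false (∧-intro y∈C′ y∈C) (none y)

    invariant′ : Invariant U′ h′ (suc m)
    invariant′ = record
      { r≤m = ℕₚ.m≤n⇒m≤1+n r≤m
      ; U⊆D = λ x p → U⊆D x (U′⊆U x p)
      ; h<m = below
      ; h-R = λ i x Rix → trans (h′-¬Z x (¬U⇒¬Z x (≢true⇒≡false λ ux →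
                            ≡true⇒≢false (U⊆D x ux) (R⇒¬outside R i x Rix)))) (h-R i x Rix)
      ; r≤h = r≤h′
      ; boundary = boundary-of }
      where
      below : ∀ x → U′ x ≡ false → h′ x < suc m
      below x ¬U′x = by-cases (true⊎false (Z x)) (true⊎false (U x))
        where
        by-cases : Z x ≡ true ⊎ Z x ≡ false → U x ≡ true ⊎ U x ≡ false → h′ x < suc m
        by-cases (inj₁ zx) _        = subst (_< suc m) (sym (h′-Z x zx)) (ℕₚ.n<1+n m)
        by-cases (inj₂ zx) (inj₂ ux) = subst (_< suc m) (sym (h′-¬Z x zx)) (ℕₚ.m<n⇒m<1+n (h<m x ux))
        by-cases (inj₂ zx) (inj₁ ux) = ⊥-elim (≡true⇒≢false (U′-intro x ux zx) ¬U′x)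
      r≤h′ : ∀ x → U′ x ≡ false → D x ≡ true → r ≤ h′ x
      r≤h′ x ¬U′x Dx = by-cases (true⊎false (Z x)) (true⊎false (U x))
        where
        by-cases : Z x ≡ true ⊎ Z x ≡ false → U x ≡ true ⊎ U x ≡ false → r ≤ h′ x
        by-cases (inj₁ zx) _        = subst (r ≤_) (sym (h′-Z x zx)) r≤m
        by-cases (inj₂ zx) (inj₂ ux) = subst (r ≤_) (sym (h′-¬Z x zx)) (r≤h x ux Dx)
        by-cases (inj₂ zx) (inj₁ ux) = ⊥-elim (≡true⇒≢false (U′-intro x ux zx) ¬U′x)

    size-U′<size-U : size U′ < size U
    size-U′<size-U = size-< U′ U U′⊆U (proj₁ Z-nonempty) (Z⊆U _ (proj₂ Z-nonempty)) (Z⇒¬U′ _ (proj₂ Z-nonempty))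

    module Lift (ext : Extension U′ h′ (suc m)) where

      open Extension ext

      f-Z : ∀ x → Z x ≡ true → f x ≡ m
      f-Z x zx = trans (f-old x (Z⇒¬U′ x zx)) (h′-Z x zx)

      f-¬U : ∀ x → U x ≡ false → f x ≡ h x
      f-¬U x ux = trans (f-old x (¬U⇒¬U′ x ux)) (h′-¬Z x (¬U⇒¬Z x ux))

      f-U′ : ∀ x → U x ≡ true → Z x ≡ false → suc m ≤ f x
      f-U′ x ux zx = f-new x (U′-intro x ux zx)

      above-m : ∀ x → (m ≤ᵇ f x) ≡ U x
      above-m x = by-cases (true⊎false (U x)) (true⊎false (Z x))
        where
        by-cases : U x ≡ true ⊎ U x ≡ false → Z x ≡ true ⊎ Z x ≡ false → (m ≤ᵇ f x) ≡ U x
        by-cases (inj₁ ux) (inj₁ zx) = trans (≤⇒≤ᵇ≡true (ℕₚ.≤-reflexive (sym (f-Z x zx)))) (sym ux)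
        by-cases (inj₁ ux) (inj₂ zx) = trans (≤⇒≤ᵇ≡true (ℕₚ.<⇒≤ (f-U′ x ux zx))) (sym ux)
        by-cases (inj₂ ux) _         = trans (>⇒≤ᵇ≡false (subst (_< m) (sym (f-¬U x ux)) (h<m x ux))) (sym ux)

      level⇒Z : ∀ x → f x ≡ m → Z x ≡ true
      level⇒Z x fx≡m = by-cases (true⊎false (U x)) (true⊎false (Z x))
        where
        by-cases : U x ≡ true ⊎ U x ≡ false → Z x ≡ true ⊎ Z x ≡ false → Z x ≡ true
        by-cases _         (inj₁ zx) = zx
        by-cases (inj₁ ux) (inj₂ zx) = ⊥-elim (ℕₚ.<-irrefl (sym fx≡m) (f-U′ x ux zx))
        by-cases (inj₂ ux) (inj₂ zx) = ⊥-elim (ℕₚ.<-irrefl fx≡m (subst (_< m) (sym (f-¬U x ux)) (h<m x ux)))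

      centered : ∀ (H : Subgraph adj) → (∀ x → vs H x ≡ true → m ≤ f x) → Connected H →
                 Σ (Fin n) (λ x → vs H x ≡ true × Z x ≡ true) →
                 ManyColors p (vs H) (λ x → D x ≡ true) φ ⊎
                 HasCenter {B = A × Fin (c * d)} (λ x → vs H x ∧ Z x) (λ x → D x ≡ true × Z x ≡ true)
                           (λ x dz → φ x (proj₁ dz) , ψ₀ x (proj₂ dz))
      centered H H-above H-connected (x₀ , x₀∈H , zx₀) = Z-centers H (H⊆C , H-edges) H-connected (x₀ , x₀∈H , zx₀)
        where
        H⊆U : vs H ⊆ U
        H⊆U x p = trans (sym (above-m x)) (≤⇒≤ᵇ≡true (H-above x p))
        H⊆C : vs H ⊆ C
        H⊆C = component-absorbs C-component H⊆U (Connected⇒InducedConnected H H-connected) x₀ x₀∈H (Z⊆C x₀ zx₀)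
        H-edges : ∀ u w → es H u w ≡ true → induce adj C u w ≡ true
        H-edges u w p = induce⁺ adj C (H⊆C u (es-vs H u w p)) (H⊆C w (es-vs H w u (trans (es-sym H w u) p))) (es-adj H u w p)

      level : Level f m
      level = record
        { C = C
        ; C-component = component-transport C-component
            (λ x cx → trans (above-m x) (C⊆U x cx)) (λ x p → trans (sym (above-m x)) p)
            (λ _ _ _ _ uw → uw) (λ _ _ _ _ uw → uw)
        ; Z = Z ; Z⇒level = f-Z ; level⇒Z = level⇒Z ; Z-nonempty = Z-nonempty ; Z⊆C = Z⊆C
        ; q = q ; q≤t′ = q≤t′ ; anchor = anchor
        ; covers = λ w u cu uw cw → proj₁ (covers w u cu uw cw) ,
                     trans (f-¬U w (≢true⇒≡false λ wU → ≡true⇒≢false (C-saturated u w cu wU uw) cw))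
                           (proj₂ (proj₂ (proj₂ (covers w u cu uw cw))))
        ; ψ = ψ₀ ; centered = centered }

      levels′ : ∀ j → m ≤ j → j < ℓ → Level f j
      levels′ j m≤j j<ℓ = by-cases (m ℕ.≟ j)
        where
        by-cases : Dec (m ≡ j) → Level f j
        by-cases (yes refl) = level
        by-cases (no m≢j)   = levels j (ℕₚ.≤∧≢⇒< m≤j m≢j) j<ℓ

      f-new′ : ∀ x → U x ≡ true → m ≤ f x
      f-new′ x ux = by-Z (true⊎false (Z x))
        where
        by-Z : Z x ≡ true ⊎ Z x ≡ false → m ≤ f x
        by-Z (inj₁ zx) = ℕₚ.≤-reflexive (sym (f-Z x zx))
        by-Z (inj₂ zx) = ℕₚ.<⇒≤ (f-U′ x ux zx)

      extension : Extension U h m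
      extension = record
        { ℓ = ℓ ; f = f ; m≤ℓ = ℕₚ.<⇒≤ m≤ℓ ; f-old = f-¬U ; f-new = f-new′ ; f<ℓ = f<ℓ ; levels = levels′ }

  extend : ∀ k {U h m} → size U ≤ k → Invariant U h m → Extension U h m
  extend k {U} {h} {m} size≤k inv = by-cases k size≤k (find U)
    where
    by-cases : ∀ k → size U ≤ k → (∃ λ v → U v ≡ true) ⊎ (∀ v → U v ≡ false) → Extension U h m
    by-cases _ _ (inj₂ empty) = record
      { ℓ = m ; f = h ; m≤ℓ = ℕₚ.≤-refl ; f-old = λ _ _ → refl
      ; f-new = λ v p → ⊥-elim (≡true⇒≢false p (empty v))
      ; f<ℓ = λ v → Invariant.h<m inv v (empty v)
      ; levels = λ j m≤j j<m → ⊥-elim (ℕₚ.<-irrefl refl (ℕₚ.<-≤-trans j<m m≤j)) }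
    by-cases zero    size≤0 (inj₁ (v , v∈U)) = ⊥-elim (ℕₚ.<-irrefl refl (ℕₚ.<-≤-trans (size>0 U v v∈U) size≤0))
    by-cases (suc k) size≤k (inj₁ (v , v∈U)) =
      Step.Lift.extension inv v v∈U
        (extend k (ℕₚ.≤-pred (ℕₚ.<-≤-trans (Step.size-U′<size-U inv v v∈U) size≤k)) (Step.invariant′ inv v v∈U))

  part-unique : ∀ {i j v} → R i v ≡ true → R j v ≡ true → i ≡ j
  part-unique {i} {j} {v} Riv Rjv =
    decidable-stable (i Fin.≟ j) λ i≢j → ≡true⇒≢false Rjv (R-disjoint i j i≢j v Riv)

  ¬outside⇒R : ∀ v → D v ≡ false → ∃ λ i → R i v ≡ true
  ¬outside⇒R v ¬Dv = anyFin-elim (λ i → R i v) (not≡false⇒≡true ¬Dv)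

  R-index-of : ∀ {v} → (∃ λ i → R i v ≡ true) ⊎ (∀ i → R i v ≡ false) → ℕ
  R-index-of (inj₁ (i , _)) = toℕ i
  R-index-of (inj₂ _)       = 0

  R-index : Fin n → ℕ
  R-index v = R-index-of (find (λ i → R i v))

  R⇒R-index≡ : ∀ i v → R i v ≡ true → R-index v ≡ toℕ i
  R⇒R-index≡ i v Riv = by-cases (find (λ i → R i v))
    where
    by-cases : (s : (∃ λ i → R i v ≡ true) ⊎ (∀ i → R i v ≡ false)) → R-index-of s ≡ toℕ i
    by-cases (inj₁ (i′ , Ri′v)) = cong toℕ (part-unique Ri′v Riv)
    by-cases (inj₂ none)        = ⊥-elim (≡true⇒≢false Riv (none i))

  ends : ∀ i → ∃₂ λ x y → R i x ≡ true × R i y ≡ true × (∀ z → R i z ≡ true → z ≡ x ⊎ z ≡ y)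
  ends i = size≤2⇒pair (R i) (size-bounds (R-size i)) (size-bounds′ (R-size i))
    where
    size-bounds : size (R i) ≡ 1 ⊎ size (R i) ≡ 2 → 0 < size (R i)
    size-bounds (inj₁ s≡1) = subst (0 <_) (sym s≡1) (s≤s z≤n)
    size-bounds (inj₂ s≡2) = subst (0 <_) (sym s≡2) (s≤s z≤n)
    size-bounds′ : size (R i) ≡ 1 ⊎ size (R i) ≡ 2 → size (R i) ≤ 2
    size-bounds′ (inj₁ s≡1) = subst (_≤ 2) (sym s≡1) (s≤s z≤n)
    size-bounds′ (inj₂ s≡2) = ℕₚ.≤-reflexive s≡2

  end : Fin r → Fin 2 → Fin n
  end i zero    = proj₁ (ends i)
  end i (suc _) = proj₁ (proj₂ (ends i))

  end-R : ∀ i b → R i (end i b) ≡ true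
  end-R i zero    = proj₁ (proj₂ (proj₂ (ends i)))
  end-R i (suc _) = proj₁ (proj₂ (proj₂ (proj₂ (ends i))))

  end-cover : ∀ i w → R i w ≡ true → Σ (Fin 2) λ b → w ≡ end i b
  end-cover i w Riw = by-cases (proj₂ (proj₂ (proj₂ (proj₂ (ends i)))) w Riw)
    where
    by-cases : w ≡ end i zero ⊎ w ≡ end i (suc zero) → Σ (Fin 2) λ b → w ≡ end i b
    by-cases (inj₁ w≡x) = zero , w≡x
    by-cases (inj₂ w≡y) = suc zero , w≡y

  -- The parts R_i themselves, split into their (at most two) vertices, are the pairs of every component of D.
  initial-pairs : ∀ {C} → C ⊆ D → AttachmentPairs C r
  initial-pairs {C} C⊆D = record
    { Y = Y ; Y-connected = λ i b → singleton-connected adj (end i b)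
    ; Y-avoids = λ i b v p → ≢true⇒≡false λ cv →
        ≡true⇒≢false (C⊆D v cv) (R⇒¬outside R i v (in-R i b v p))
    ; Y-disjoint = λ a a′ a≢a′ b b′ v p → ≢true⇒≡false λ p′ →
        a≢a′ (part-unique (in-R a b v p) (in-R a′ b′ v p′)) }
    where
    Y : Fin r → Fin 2 → Pred n
    Y i b = singleton (end i b)
    in-R : ∀ i b v → Y i b v ≡ true → R i v ≡ true
    in-R i b v p = subst (λ x → R i x ≡ true) (sym (does⇒ (v Fin.≟ end i b) p)) (end-R i b)

  initial : Invariant D R-index r
  initial = record
    { r≤m = ℕₚ.≤-refl
    ; U⊆D = λ _ p → p
    ; h<m = λ v ¬Dv → let i = proj₁ (¬outside⇒R v ¬Dv) in
              subst (_< r) (sym (R⇒R-index≡ i v (proj₂ (¬outside⇒R v ¬Dv)))) (Finₚ.toℕ<n i)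
    ; h-R = R⇒R-index≡
    ; r≤h = λ v ¬Dv Dv → ⊥-elim (≡true⇒≢false Dv ¬Dv)
    ; boundary = λ C C-component → record
        { q = r ; q≤t′ = r≤t′ ; pairs = initial-pairs (proj₁ C-component) ; anchor = toℕ
        ; covers = λ w u cu uw cw →
            let ¬Dw = ≢true⇒≡false λ Dw → ≡true⇒≢false (proj₂ (proj₂ C-component) u w cu Dw uw) cw
                i = proj₁ (¬outside⇒R w ¬Dw)
                Riw = proj₂ (¬outside⇒R w ¬Dw)
            in i , proj₁ (end-cover i w Riw) , dec-true (w Fin.≟ _) (proj₂ (end-cover i w Riw)) , R⇒R-index≡ i w Riw } }

  -- Node 0 of the tree has bag {R_1, …, R_r}; node j + 1 has bag {P_j} together with the parts P_j is
  -- attached to (those meeting N(C_j)), and hangs below the latest of them.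
  module Decomposition (ext : Extension D R-index r) where

    open Extension ext public

    part : Fin n → Fin ℓ
    part v = fromℕ< (f<ℓ v)

    part⇒f : ∀ {v j} → part v ≡ j → f v ≡ toℕ j
    part⇒f {v} refl = sym (Finₚ.toℕ-fromℕ< (f<ℓ v))

    f⇒part : ∀ {v j} → f v ≡ toℕ j → part v ≡ j
    f⇒part {v} fv≡j = Finₚ.toℕ-injective (trans (Finₚ.toℕ-fromℕ< (f<ℓ v)) fv≡j)

    f-R : ∀ i v → R i v ≡ true → f v ≡ toℕ i
    f-R i v Riv = trans (f-old v (R⇒¬outside R i v Riv)) (R⇒R-index≡ i v Riv)

    f⇒R : ∀ i v → f v ≡ toℕ i → R i v ≡ true
    f⇒R i v fv≡i = by-cases (true⊎false (D v))
      where
      by-cases : D v ≡ true ⊎ D v ≡ false → R i v ≡ true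
      by-cases (inj₁ Dv)  = ⊥-elim (ℕₚ.<-irrefl refl (ℕₚ.<-≤-trans (subst (_< r) (sym fv≡i) (Finₚ.toℕ<n i)) (f-new v Dv)))
      by-cases (inj₂ ¬Dv) = subst (λ k → R k v ≡ true)
                              (Finₚ.toℕ-injective (trans (sym (f-R _ v (proj₂ (¬outside⇒R v ¬Dv)))) fv≡i))
                              (proj₂ (¬outside⇒R v ¬Dv))

    fixed : Fin ℓ → Bool
    fixed j = does (toℕ j ℕ.<? r)

    fixed⇒< : ∀ j → fixed j ≡ true → toℕ j < r
    fixed⇒< j = does⇒ (toℕ j ℕ.<? r)

    <⇒fixed : ∀ j → toℕ j < r → fixed j ≡ true
    <⇒fixed j = dec-true (toℕ j ℕ.<? r)

    ¬fixed⇒≥ : ∀ j → fixed j ≡ false → r ≤ toℕ j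
    ¬fixed⇒≥ j ¬fixed = ℕₚ.≮⇒≥ λ j<r → ≡true⇒≢false (<⇒fixed j j<r) ¬fixed

    level-at : ∀ j → r ≤ toℕ j → Level f (toℕ j)
    level-at j r≤j = levels (toℕ j) r≤j (Finₚ.toℕ<n j)

    region-of : ∀ j → Dec (r ≤ toℕ j) → Pred n
    region-of j (yes r≤j) = Level.C (level-at j r≤j)
    region-of j (no _)    = λ _ → false

    region : Fin ℓ → Pred n
    region j = region-of j (r ℕ.≤? toℕ j)

    region-level : ∀ j → r ≤ toℕ j → Σ (Level f (toℕ j)) λ L → region j ≡ Level.C L
    region-level j r≤j = by-cases (r ℕ.≤? toℕ j)
      where
      by-cases : (r≤?j : Dec (r ≤ toℕ j)) → Σ (Level f (toℕ j)) λ L → region-of j r≤?j ≡ Level.C L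
      by-cases (yes r≤j′) = level-at j r≤j′ , refl
      by-cases (no r≰j)   = ⊥-elim (r≰j r≤j)

    Attached : Pred n → Fin ℓ → Set
    Attached C a = Σ (Fin n) λ w → Σ (Fin n) λ u → C u ≡ true × adj u w ≡ true × C w ≡ false × part w ≡ a

    attached? : ∀ C a → Dec (Attached C a)
    attached? C a = any? λ w → any? λ u →
      (C u Bool.≟ true) ×-dec (adj u w Bool.≟ true) ×-dec (C w Bool.≟ false) ×-dec (part w Fin.≟ a)

    att : Fin ℓ → Fin ℓ → Bool
    att j a = does (attached? (region j) a)

    att⇒attached : ∀ {j a} (L : Level f (toℕ j)) → region j ≡ Level.C L → att j a ≡ true → Attached (Level.C L) a
    att⇒attached {j} {a} L eq p = subst (λ C → Attached C a) eq (does⇒ (attached? (region j) a) p)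

    attached⇒att : ∀ {j a} (L : Level f (toℕ j)) → region j ≡ Level.C L → Attached (Level.C L) a → att j a ≡ true
    attached⇒att {j} {a} L eq p = dec-true (attached? (region j) a) (subst (λ C → Attached C a) (sym eq) p)

    attached-below : ∀ {j a} (L : Level f j) → Attached (Level.C L) a → toℕ a < j
    attached-below L (w , u , cu , uw , cw , w∈a) =
      subst (_< _) (part⇒f w∈a) (ℕₚ.≰⇒> λ j≤fw → ≡true⇒≢false (proj₂ (proj₂ (Level.C-component L)) u w cu (≤⇒≤ᵇ≡true j≤fw) uw) cw)

    -- C_j ⊆ C_i whenever P_j is attached to P_i, so attachments of P_j below P_i are attachments of P_i.
    attached-laminar : ∀ {i j} (Li : Level f (toℕ i)) (Lj : Level f j) → toℕ i < j →
                       Attached (Level.C Lj) i → ∀ {b} → Attached (Level.C Lj) b → toℕ b < toℕ i → Attached (Level.C Li) b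
    attached-laminar {i} {j} Li Lj i<j (w , u , cu , uw , _ , w∈i) (w₂ , u₂ , cu₂ , uw₂ , _ , w₂∈b) b<i =
      w₂ , u₂ , Cj⊆Ci u₂ cu₂ , uw₂ , w₂∉Ci , w₂∈b
      where
      Ci-component = Level.C-component Li
      Cj-component = Level.C-component Lj
      Cj-above-i : Level.C Lj ⊆ (λ x → toℕ i ≤ᵇ f x)
      Cj-above-i x cx = ≤⇒≤ᵇ≡true (ℕₚ.≤-trans (ℕₚ.<⇒≤ i<j) (≤ᵇ≡true⇒≤ (proj₁ Cj-component x cx)))
      w∈Ci : Level.C Li w ≡ true
      w∈Ci = Level.Z⊆C Li w (Level.level⇒Z Li w (part⇒f w∈i))
      u∈Ci : Level.C Li u ≡ true
      u∈Ci = proj₂ (proj₂ Ci-component) w u w∈Ci (Cj-above-i u cu) (trans (adj-sym w u) uw)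
      Cj⊆Ci : Level.C Lj ⊆ Level.C Li
      Cj⊆Ci = component-absorbs Ci-component Cj-above-i (proj₁ (proj₂ Cj-component)) u cu u∈Ci
      w₂∉Ci : Level.C Li w₂ ≡ false
      w₂∉Ci = ≢true⇒≡false λ c → ℕₚ.<⇒≱ (subst (_< toℕ i) (sym (part⇒f w₂∈b)) b<i) (≤ᵇ≡true⇒≤ (proj₁ Ci-component w₂ c))

    att-below : ∀ j a → r ≤ toℕ j → att j a ≡ true → toℕ a < toℕ j
    att-below j a r≤j p = by-level (region-level j r≤j)
      where
      by-level : Σ (Level f (toℕ j)) (λ L → region j ≡ Level.C L) → toℕ a < toℕ j
      by-level (L , eq) = attached-below L (att⇒attached L eq p)

    att-laminar : ∀ i j b → r ≤ toℕ i → toℕ i < toℕ j → att j i ≡ true → att j b ≡ true → toℕ b < toℕ i → att i b ≡ true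
    att-laminar i j b r≤i i<j j-i j-b b<i = by-levels (region-level i r≤i) (region-level j (ℕₚ.≤-trans r≤i (ℕₚ.<⇒≤ i<j)))
      where
      by-levels : Σ (Level f (toℕ i)) (λ L → region i ≡ Level.C L) → Σ (Level f (toℕ j)) (λ L → region j ≡ Level.C L) →
                  att i b ≡ true
      by-levels (Li , eqi) (Lj , eqj) =
        attached⇒att Li eqi (attached-laminar Li Lj i<j (att⇒attached Lj eqj j-i) (att⇒attached Lj eqj j-b) b<i)

    parent-of : ∀ {j} → (Σ (Fin ℓ) λ a → att j a ≡ true × (∀ b → att j b ≡ true → toℕ b ≤ toℕ a)) ⊎ (∀ b → att j b ≡ false) →
                Fin (suc ℓ)
    parent-of (inj₁ (a , _)) = suc a
    parent-of (inj₂ _)       = zero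

    node-parent : Fin ℓ → Bool → Fin (suc ℓ)
    node-parent j true  = zero
    node-parent j false = parent-of (find-last (att j))

    parent : Fin (suc ℓ) → Fin (suc ℓ)
    parent zero    = zero
    parent (suc j) = node-parent j (fixed j)

    parent-< : ∀ x → x ≢ zero → toℕ (parent x) < toℕ x
    parent-< zero    x≢0 = ⊥-elim (x≢0 refl)
    parent-< (suc j) _   = by-cases (fixed j) refl
      where
      below-last : (l : _) → r ≤ toℕ j → toℕ (parent-of {j} l) < suc (toℕ j)
      below-last (inj₁ (a , a-att , _)) r≤j = s≤s (att-below j a r≤j a-att)
      below-last (inj₂ _)               _   = s≤s z≤n
      by-cases : ∀ fj → fixed j ≡ fj → toℕ (node-parent j fj) < suc (toℕ j)
      by-cases true  _      = s≤s z≤n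
      by-cases false ¬fixed = below-last (find-last (att j)) (¬fixed⇒≥ j ¬fixed)

    open ParentTree parent parent-< public

    node-bag : Fin ℓ → Bool → Pred ℓ
    node-bag j true    = fixed
    node-bag j false b = does (j Fin.≟ b) ∨ att j b

    bag : Fin (suc ℓ) → Pred ℓ
    bag zero    = fixed
    bag (suc j) = node-bag j (fixed j)

    bag-at : ∀ j b {fj} → fixed j ≡ fj → bag (suc j) b ≡ node-bag j fj b
    bag-at j b eq = cong (λ fj → node-bag j fj b) eq

    own-bag : ∀ b → bag (suc b) b ≡ true
    own-bag b = by-cases (fixed b) refl
      where
      by-cases : ∀ fb → fixed b ≡ fb → node-bag b fb b ≡ true
      by-cases true  fixed-b = fixed-b
      by-cases false _       = ∨-introˡ _ (dec-true (b Fin.≟ b) refl)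

    in-bag-of-last : ∀ j b a → r ≤ toℕ j → att j b ≡ true → att j a ≡ true → toℕ b ≤ toℕ a → bag (suc a) b ≡ true
    in-bag-of-last j b a r≤j j-b j-a b≤a = by-order (ℕₚ.m≤n⇒m<n∨m≡n b≤a)
      where
      by-fixed : toℕ b < toℕ a → (fa : Bool) → fixed a ≡ fa → bag (suc a) b ≡ true
      by-fixed b<a true  fixed-a = trans (bag-at a b fixed-a) (<⇒fixed b (ℕₚ.<-trans b<a (fixed⇒< a fixed-a)))
      by-fixed b<a false ¬fixed-a = trans (bag-at a b ¬fixed-a)
        (∨-introʳ (does (a Fin.≟ b)) (att-laminar a j b (¬fixed⇒≥ a ¬fixed-a) (att-below j a r≤j j-a) j-a j-b b<a))
      by-order : toℕ b < toℕ a ⊎ toℕ b ≡ toℕ a → bag (suc a) b ≡ true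
      by-order (inj₁ b<a) = by-fixed b<a (fixed a) refl
      by-order (inj₂ b≡a) = subst (λ z → bag (suc a) z ≡ true) (sym (Finₚ.toℕ-injective b≡a)) (own-bag a)

    module RunningIntersection (b : Fin ℓ) where

      top-of : Bool → Fin (suc ℓ)
      top-of true  = zero
      top-of false = suc b

      top : Fin (suc ℓ)
      top = top-of (fixed b)

      top-bag : ∀ fb → fixed b ≡ fb → bag (top-of fb) b ≡ true
      top-bag true  fixed-b = fixed-b
      top-bag false _       = own-bag b

      up-last : ∀ j → r ≤ toℕ j → att j b ≡ true → (l : _) → bag (parent-of {j} l) b ≡ true
      up-last j r≤j j-b (inj₁ (a , j-a , max)) = in-bag-of-last j b a r≤j j-b j-a (max b j-b)
      up-last j r≤j j-b (inj₂ none)            = ⊥-elim (≡true⇒≢false j-b (none b))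

      up-node : ∀ j → suc j ≢ top → ∀ fj → fixed j ≡ fj → node-bag j fj b ≡ true → bag (node-parent j fj) b ≡ true
      up-node j _     true  _      b∈bag = b∈bag
      up-node j j≢top false ¬fixed b∈bag with ∨-elim (does (j Fin.≟ b)) b∈bag
      ... | inj₁ j≡b = ⊥-elim (j≢top (suc-j≡top (does⇒ (j Fin.≟ b) j≡b)))
        where
        suc-j≡top : j ≡ b → suc j ≡ top
        suc-j≡top refl = cong top-of (sym ¬fixed)
      ... | inj₂ j-b = up-last j (¬fixed⇒≥ j ¬fixed) j-b (find-last (att j))

      up : ∀ x → bag x b ≡ true → x ≢ top → x ≢ zero × bag (parent x) b ≡ true
      up zero    b∈bag x≢top = ⊥-elim (x≢top (cong top-of (sym b∈bag)))
      up (suc j) b∈bag x≢top = (λ ()) , up-node j x≢top (fixed j) refl b∈bag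

      connected : InducedConnected edge (λ x → bag x b)
      connected = upward-closed-connected (λ x → bag x b) top (top-bag (fixed b) refl) up

    edge-covered-< : ∀ j k u v → toℕ j < toℕ k → part u ≡ j → part v ≡ k → adj u v ≡ true →
                     Σ (Fin (suc ℓ)) λ x → bag x j ≡ true × bag x k ≡ true
    edge-covered-< j k u v j<k u∈j v∈k uv = by-fixed (fixed k) refl
      where
      by-level : Σ (Level f (toℕ k)) (λ L → region k ≡ Level.C L) → att k j ≡ true
      by-level (L , eq) = attached⇒att L eq (u , v , v∈C , trans (adj-sym v u) uv , u∉C , u∈j)
        where
        v∈C = Level.Z⊆C L v (Level.level⇒Z L v (part⇒f v∈k))
        u∉C = ≢true⇒≡false λ c → ℕₚ.<⇒≱ (subst (_< toℕ k) (sym (part⇒f u∈j)) j<k)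
                                        (≤ᵇ≡true⇒≤ (proj₁ (Level.C-component L) u c))
      by-fixed : ∀ fk → fixed k ≡ fk → Σ (Fin (suc ℓ)) λ x → bag x j ≡ true × bag x k ≡ true
      by-fixed true  fixed-k = zero , <⇒fixed j (ℕₚ.<-trans j<k (fixed⇒< k fixed-k)) , fixed-k
      by-fixed false ¬fixed-k =
        suc k , trans (bag-at k j ¬fixed-k) (∨-introʳ (does (k Fin.≟ j)) (by-level (region-level k (¬fixed⇒≥ k ¬fixed-k)))) ,
        own-bag k

    edge-covered : ∀ j k → QuotAdj adj part j k → Σ (Fin (suc ℓ)) λ x → bag x j ≡ true × bag x k ≡ true
    edge-covered j k (j≢k , u , v , u∈j , v∈k , uv) with ℕₚ.<-cmp (toℕ j) (toℕ k)
    ... | tri< j<k _ _ = edge-covered-< j k u v j<k u∈j v∈k uv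
    ... | tri≈ _ j≡k _ = ⊥-elim (j≢k (Finₚ.toℕ-injective j≡k))
    ... | tri> _ _ k<j = let (x , k∈x , j∈x) = edge-covered-< k j v u k<j v∈k u∈j (trans (adj-sym v u) uv) in x , j∈x , k∈x

    fixed-size : size fixed ≤ suc t′
    fixed-size = ℕₚ.≤-trans (size-≤-image r fixed toℕ λ b p → fromℕ< (fixed⇒< b p) , sym (Finₚ.toℕ-fromℕ< (fixed⇒< b p)))
                            (ℕₚ.≤-trans r≤t′ (ℕₚ.n≤1+n t′))

    -- Besides P_j itself, a bag holds only parts at the anchor levels of C_j, of which there are at most t − 2.
    node-size : ∀ j → r ≤ toℕ j → size (node-bag j false) ≤ suc t′
    node-size j r≤j = by-level (region-level j r≤j)
      where
      by-level : Σ (Level f (toℕ j)) (λ L → region j ≡ Level.C L) → size (node-bag j false) ≤ suc t′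
      by-level (L , eq) = ℕₚ.≤-trans (size-≤-image (suc (Level.q L)) (node-bag j false) levels-in-bag in-image)
                                      (s≤s (Level.q≤t′ L))
        where
        levels-in-bag : Fin (suc (Level.q L)) → ℕ
        levels-in-bag = toℕ j ∷ Level.anchor L
        anchored : ∀ a → Attached (Level.C L) a → Σ (Fin (suc (Level.q L))) λ i → toℕ a ≡ levels-in-bag i
        anchored a (w , u , cu , uw , cw , w∈a) =
          suc (proj₁ (Level.covers L w u cu uw cw)) , trans (sym (part⇒f w∈a)) (proj₂ (Level.covers L w u cu uw cw))
        in-image : ∀ a → node-bag j false a ≡ true → Σ (Fin (suc (Level.q L))) λ i → toℕ a ≡ levels-in-bag i
        in-image a p with ∨-elim (does (j Fin.≟ a)) p
        ... | inj₁ j≡a = zero , cong toℕ (sym (does⇒ (j Fin.≟ a) j≡a))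
        ... | inj₂ j-a = anchored a (att⇒attached L eq j-a)

    width : WidthAtMost t′ bag
    width zero    = fixed-size
    width (suc j) = by-fixed (fixed j) refl
      where
      by-fixed : ∀ fj → fixed j ≡ fj → size (node-bag j fj) ≤ suc t′
      by-fixed true  _      = fixed-size
      by-fixed false ¬fixed = node-size j (¬fixed⇒≥ j ¬fixed)

    eliminate-built : ∀ i z j → fixed i ≡ false → bag z i ≡ true → bag z j ≡ true → toℕ j < toℕ i → bag (suc i) j ≡ true
    eliminate-built i zero    j ¬fixed-i i∈z _ _ = ⊥-elim (≡true⇒≢false i∈z ¬fixed-i)
    eliminate-built i (suc z) j ¬fixed-i i∈z j∈z j<i = by-fixed (fixed z) refl
      where
      by-fixed : ∀ fz → fixed z ≡ fz → bag (suc i) j ≡ true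
      by-fixed true  fixed-z = ⊥-elim (≡true⇒≢false (trans (sym (bag-at z i fixed-z)) i∈z) ¬fixed-i)
      by-fixed false ¬fixed-z with ∨-elim (does (z Fin.≟ i)) (trans (sym (bag-at z i ¬fixed-z)) i∈z)
      ... | inj₁ z≡i = subst (λ y → bag (suc y) j ≡ true) (does⇒ (z Fin.≟ i) z≡i) j∈z
      ... | inj₂ z-i with ∨-elim (does (z Fin.≟ j)) (trans (sym (bag-at z j ¬fixed-z)) j∈z)
      ...   | inj₁ z≡j = ⊥-elim (ℕₚ.<-asym j<i (subst (λ y → toℕ i < toℕ y) (does⇒ (z Fin.≟ j) z≡j)
                                                       (att-below z i (¬fixed⇒≥ z ¬fixed-z) z-i)))
      ...   | inj₂ z-j = trans (bag-at i j ¬fixed-i)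
                           (∨-introʳ (does (i Fin.≟ j)) (att-laminar i z j (¬fixed⇒≥ i ¬fixed-i)
                              (att-below z i (¬fixed⇒≥ z ¬fixed-z) z-i) z-i z-j j<i))

    elimination : IsEliminationOrdering bag
    elimination i = by-fixed (fixed i) refl
      where
      by-fixed : ∀ fi → fixed i ≡ fi → Σ (Fin (suc ℓ)) λ x → ∀ z j → bag z i ≡ true → bag z j ≡ true → toℕ j < toℕ i → bag x j ≡ true
      by-fixed true  fixed-i  = zero , λ _ j _ _ j<i → <⇒fixed j (ℕₚ.<-trans j<i (fixed⇒< i fixed-i))
      by-fixed false ¬fixed-i = suc i , λ z j → eliminate-built i z j ¬fixed-i

    R-part : ∀ i v → block part (inject≤ i m≤ℓ) v ≡ R i v
    R-part i v = by-cases (true⊎false (R i v))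
      where
      toℕ-i = Finₚ.toℕ-inject≤ i m≤ℓ
      by-cases : R i v ≡ true ⊎ R i v ≡ false → block part (inject≤ i m≤ℓ) v ≡ R i v
      by-cases (inj₁ Riv)  = trans (block⁺ part (f⇒part (trans (f-R i v Riv) (sym toℕ-i)))) (sym Riv)
      by-cases (inj₂ ¬Riv) = trans (block-false part λ e → ≡true⇒≢false (f⇒R i v (trans (part⇒f e) toℕ-i)) ¬Riv)
                                   (sym ¬Riv)

    R-in-root : ∀ i → bag zero (inject≤ i m≤ℓ) ≡ true
    R-in-root i = <⇒fixed _ (subst (_< r) (sym (Finₚ.toℕ-inject≤ i m≤ℓ)) (Finₚ.toℕ<n i))

    part-surjective : Surjective part
    part-surjective j = by-fixed (fixed j) refl
      where
      by-fixed : ∀ fj → fixed j ≡ fj → Σ (Fin n) λ v → part v ≡ j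
      by-fixed true fixed-j =
        let i = fromℕ< (fixed⇒< j fixed-j) in
        end i zero , f⇒part (trans (f-R i _ (end-R i zero)) (Finₚ.toℕ-fromℕ< (fixed⇒< j fixed-j)))
      by-fixed false ¬fixed-j =
        let L = level-at j (¬fixed⇒≥ j ¬fixed-j) in
        proj₁ (Level.Z-nonempty L) , f⇒part (Level.Z⇒level L _ (proj₂ (Level.Z-nonempty L)))

    not-a-given-part : ∀ j → (∀ i → Σ (Fin n) λ v → block part j v ≢ R i v) → r ≤ toℕ j
    not-a-given-part j differs = ℕₚ.≮⇒≥ λ j<r →
      let i = fromℕ< j<r ; v = proj₁ (differs i) in
      proj₂ (differs i) (subst (λ z → block part z v ≡ R i v) (inject≤-fromℕ< j<r) (R-part i v))
      where
      inject≤-fromℕ< : ∀ j<r → inject≤ (fromℕ< j<r) m≤ℓ ≡ j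
      inject≤-fromℕ< j<r = Finₚ.toℕ-injective (trans (Finₚ.toℕ-inject≤ _ m≤ℓ) (Finₚ.toℕ-fromℕ< j<r))

    c*d≡ : c * d ≡ c * 2 ^ t′ * suc t′
    c*d≡ = sym (ℕₚ.*-assoc c (2 ^ t′) (suc t′))

    module Colouring (j : Fin ℓ) (r≤j : r ≤ toℕ j) where

      L = level-at j r≤j
      open Level L using (Z; Z⇒level; level⇒Z)

      ψ : (v : Fin n) → part v ≡ j → Fin (c * 2 ^ t′ * suc t′)
      ψ v v∈j = Fin.cast c*d≡ (Level.ψ L v (level⇒Z v (part⇒f v∈j)))

      HasCenter-in-part : Subgraph adj → Set
      HasCenter-in-part H = HasCenter (λ v → vs H v ∧ block part j v) (λ v → outside R v ≡ true × part v ≡ j)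
                                      (λ v dp → φ v (proj₁ dp) , ψ v (proj₂ dp))

      to-part : ∀ H → HasCenter {B = A × Fin (c * d)} (λ v → vs H v ∧ Z v) (λ v → D v ≡ true × Z v ≡ true)
                                (λ v dz → φ v (proj₁ dz) , Level.ψ L v (proj₂ dz)) → HasCenter-in-part H
      to-part H = HasCenter-transport (Product.map₂ (Fin.cast c*d≡))
        (λ e → ×-≡,≡→≡ (cong proj₁ e , cast-injective c*d≡ (cong proj₂ e)))
        (λ v p → ∧-intro (∧-conicalˡ (vs H v) _ p) (block⁺ part (f⇒part (Z⇒level v (∧-conicalʳ (vs H v) _ p)))))
        (λ v p → ∧-intro (∧-conicalˡ (vs H v) _ p) (level⇒Z v (part⇒f (block⁻ part (∧-conicalʳ (vs H v) _ p)))))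
        (λ v dz → proj₁ dz , f⇒part (Z⇒level v (proj₂ dz)))
        (λ v dp → proj₁ dp , level⇒Z v (part⇒f (proj₂ dp)))
        (λ v dz → cong (proj₁ dz ,_) (Decidable⇒UIP.≡-irrelevant Bool._≟_ _ _))
        (λ _ _ → refl)

      centered : ∀ (H : Subgraph adj) → (∀ v → vs H v ≡ true → toℕ j ≤ toℕ (part v)) → Connected H →
                 Σ (Fin n) (λ v → vs H v ≡ true × part v ≡ j) →
                 ManyColors p (vs H) (λ v → outside R v ≡ true) φ ⊎ HasCenter-in-part H
      centered H H-above H-connected (v₀ , v₀∈H , v₀∈j) =
        Sum.map₂ (to-part H) (Level.centered L H above H-connected (v₀ , v₀∈H , level⇒Z v₀ (part⇒f v₀∈j)))
        where
        above : ∀ v → vs H v ≡ true → toℕ j ≤ f v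
        above v p = subst (toℕ j ≤_) (Finₚ.toℕ-fromℕ< (f<ℓ v)) (H-above v p)

    colouring : ∀ j → (∀ i → Σ (Fin n) λ v → block part j v ≢ R i v) →
                Σ ((v : Fin n) → part v ≡ j → Fin (c * 2 ^ t′ * suc t′)) λ ψ →
                  ∀ (H : Subgraph adj) → (∀ v → vs H v ≡ true → toℕ j ≤ toℕ (part v)) → Connected H →
                  Σ (Fin n) (λ v → vs H v ≡ true × part v ≡ j) →
                  ManyColors p (vs H) (λ v → outside R v ≡ true) φ ⊎
                  HasCenter (λ v → vs H v ∧ block part j v) (λ v → outside R v ≡ true × part v ≡ j)
                            (λ v dp → φ v (proj₁ dp) , ψ v (proj₂ dp))
    colouring j differs = Colouring.ψ j r≤j , Colouring.centered j r≤j
      where r≤j = not-a-given-part j differs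

lemma11 : {A : Set} (t p c : ℕ) → 2 ≤ t → 1 ≤ p → 1 ≤ c →
    (G : Graph) → KtMinorFree t G →
    (r : ℕ) → r ≤ t ∸ 2 →
    (R : Fin r → Fin (Graph.n G) → Bool) →
    (∀ i j → i ≢ j → ∀ v → R i v ≡ true → R j v ≡ false) →
    (∀ i → size (R i) ≡ 1 ⊎ size (R i) ≡ 2) →
    (φ : (v : Fin (Graph.n G)) → outside R v ≡ true → A) →
    Good (Graph.adj G) (outside R) φ p c →
    Σ ℕ λ ℓ → Σ (Fin (Graph.n G) → Fin ℓ) λ f → Surjective f ×
    Σ ℕ λ k → Σ (Fin k → Fin k → Bool) λ T → Σ (Fin k → Fin ℓ → Bool) λ W →
      IsTreeDecomposition (QuotAdj (Graph.adj G) f) T W ×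
      WidthAtMost (t ∸ 2) W ×
      IsEliminationOrdering W ×
      Σ (r ≤ ℓ) λ r≤ℓ →
        (∀ i v → block f (inject≤ i r≤ℓ) v ≡ R i v) ×
        Σ (Fin k) (λ s → ∀ i → W s (inject≤ i r≤ℓ) ≡ true) ×
        (∀ j → (∀ i → Σ (Fin (Graph.n G)) λ v → block f j v ≢ R i v) →
          Σ ((v : Fin (Graph.n G)) → f v ≡ j → Fin (c * 2 ^ (t ∸ 2) * (t ∸ 1))) λ ψ →
            ∀ (H : Subgraph (Graph.adj G)) →
              (∀ v → vs H v ≡ true → toℕ j ≤ toℕ (f v)) → Connected H →
              Σ (Fin (Graph.n G)) (λ v → vs H v ≡ true × f v ≡ j) →
              ManyColors p (vs H) (λ v → outside R v ≡ true) φ ⊎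
              HasCenter (λ v → vs H v ∧ block f j v)
                        (λ v → outside R v ≡ true × f v ≡ j)
                        (λ v dp → φ v (proj₁ dp) , ψ v (proj₂ dp)))
lemma11 zero       _ _ ()       _ _ _ _ _ _ _ _ _ _ _
lemma11 (suc zero) _ _ (s≤s ()) _ _ _ _ _ _ _ _ _ _ _
lemma11 (suc (suc t′)) p c _ _ _ G Kt-free r r≤t′ R R-disjoint R-size φ φ-good =
  ℓ , part , part-surjective , suc ℓ , edge , bag ,
  (is-tree , RunningIntersection.connected , edge-covered) , width , elimination ,
  m≤ℓ , R-part , (zero , R-in-root) , colouring
  where
  open Construction t′ p c G Kt-free r r≤t′ R R-disjoint R-size φ φ-good
  open Decomposition (extend (Graph.n G) (size-≤ D) initial)
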